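{- Let $G$ be a graph and let $H$ be obtained from $G$ by gluing a tree to a vertex of $G$ (i.e. identifying one vertex of a tree $T$, disjoint from $G$, with a vertex of $G$). Then $\tau_G=\tau_H$.
   Context: All graphs are finite and simple. $X_G=\sum_\kappa\prod_{v}x_{\kappa(v)}$ over proper colourings $\kappa:V(G)\to\mathbb{Z}_{>0}$ is the chromatic symmetric function. For a partition $\lambda=(\lambda_1,\dots,\lambda_\ell)$, $\ell(\lambda)=\ell$ and $P_\lambda$ is the disjoint union of paths with $\lambda_1,\dots,\lambda_\ell$ vertices; $\{X_{P_\lambda}\}$ is a basis of the symmetric functions over $\mathbb{Q}$. The tree polynomial is $\tau_G(x)=\sum_\lambda a_\lambda x^{\ell(\lambda)}$ where $X_G=\sum_\lambda a_\lambda X_{P_\lambda}$. -}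

module Defs where

open import Data.Nat using (ℕ; zero; suc; _+_; _≤_; _≥_; _≡ᵇ_)
open import Data.Fin using (Fin; toℕ; splitAt; punchIn; _≟_)
open import Data.Bool using (Bool; true; false; _∧_; _∨_; not; if_then_else_)
open import Data.Sum using (inj₁; inj₂)
open import Data.Product using (_×_; _,_; proj₁; proj₂; ∃; ∃-syntax)
open import Data.List using (List; []; _∷_; _++_; [_]; map; concatMap; allFin; length; foldr)
open import Data.Bool.ListAction using (all)
open import Data.List.Relation.Unary.All using (All)
open import Data.List.Relation.Unary.Linked using (Linked)
open import Data.List.Relation.Unary.Unique.Propositional using (Unique)
open import Data.Vec.Functional using () renaming (_∷_ to _∷f_)
open import Data.Integer using (+_)
open import Data.Rational using (ℚ; 0ℚ; _/_) renaming (_+_ to _+ℚ_; _*_ to _*ℚ_)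
open import Relation.Nullary using (¬_)
open import Relation.Nullary.Decidable using (⌊_⌋)
open import Relation.Binary.PropositionalEquality using (_≡_)

Graph : ℕ → Set
Graph n = Fin n → Fin n → Bool

Adj : ∀ {n} → Graph n → Fin n → Fin n → Set
Adj G u v = G u v ≡ true

SimpleGraph : ∀ {n} → Graph n → Set
SimpleGraph {n} G = (∀ (u v : Fin n) → G u v ≡ G v u) × (∀ (u : Fin n) → G u u ≡ false)

data Walk {n} (G : Graph n) : Fin n → Fin n → Set where
  stay : ∀ {u} → Walk G u u
  step : ∀ {u w v} → Adj G u w → Walk G w v → Walk G u v

Connected : ∀ {n} → Graph n → Set
Connected {n} G = ∀ (u v : Fin n) → Walk G u v

HasCycle : ∀ {n} → Graph n → Set
HasCycle {n} G = ∃[ x ] ∃[ ys ]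
  (length ys ≥ 2 × Unique (x ∷ ys) × Linked (Adj G) (x ∷ ys ++ [ x ]))

IsTree : ∀ {n} → Graph n → Set
IsTree G = SimpleGraph G × Connected G × ¬ HasCycle G

pathG : (m : ℕ) → Graph m
pathG m i j = (suc (toℕ i) ≡ᵇ toℕ j) ∨ (suc (toℕ j) ≡ᵇ toℕ i)

emptyG : Graph 0
emptyG ()

_⊕_ : ∀ {m n} → Graph m → Graph n → Graph (m + n)
_⊕_ {m} G H i j with splitAt m i | splitAt m j
... | inj₁ a | inj₁ b = G a b
... | inj₂ a | inj₂ b = H a b
... | inj₁ _ | inj₂ _ = false
... | inj₂ _ | inj₁ _ = false

sumℕ : List ℕ → ℕ
sumℕ = foldr _+_ 0

P : (λ' : List ℕ) → Graph (sumℕ λ')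
P [] = emptyG
P (p ∷ ps) = pathG p ⊕ P ps

IsPartition : List ℕ → Set
IsPartition λ' = All (1 ≤_) λ' × Linked _≥_ λ'

-- Gluing the tree T (vertices Fin (suc m)) to G (vertices Fin n) by
-- identifying vertex t of T with vertex v of G.  The vertices of the
-- result are those of G (via inj₁) followed by those of T other than t
-- (vertex a of Fin m stands for punchIn t a).
glue : ∀ {n m} → Graph n → Fin n → Graph (suc m) → Fin (suc m) → Graph (n + m)
glue {n} G v T t i j with splitAt n i | splitAt n j
... | inj₁ a | inj₁ b = G a b
... | inj₂ a | inj₂ b = T (punchIn t a) (punchIn t b)
... | inj₁ a | inj₂ b = ⌊ a ≟ v ⌋ ∧ T t (punchIn t b)
... | inj₂ a | inj₁ b = ⌊ b ≟ v ⌋ ∧ T (punchIn t a) t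

countB : ∀ {A : Set} → (A → Bool) → List A → ℕ
countB p [] = 0
countB p (x ∷ xs) = if p x then suc (countB p xs) else countB p xs

allFuns : ∀ n k → List (Fin n → Fin k)
allFuns zero k = (λ ()) ∷ []
allFuns (suc n) k = concatMap (λ c → map (λ f → c ∷f f) (allFuns n k)) (allFin k)

isProper : ∀ {n k} → Graph n → (Fin n → Fin k) → Bool
isProper {n} G κ = all (λ i → all (λ j → not (G i j ∧ ⌊ κ i ≟ κ j ⌋)) (allFin n)) (allFin n)

hasType : ∀ {n k} → (Fin n → Fin k) → (Fin k → ℕ) → Bool
hasType {n} {k} κ α = all (λ c → countB (λ i → ⌊ κ i ≟ c ⌋) (allFin n) ≡ᵇ α c) (allFin k)

-- Coefficient of the monomial x_1^{α 0} ⋯ x_k^{α (k-1)} in X_G: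
-- the number of proper colourings with colours in {1,…,k} (colour c+1
-- encoded as c : Fin k) in which colour c+1 is used exactly α c times.
coeffX : ∀ {n} → Graph n → (k : ℕ) → (Fin k → ℕ) → ℕ
coeffX {n} G k α = countB (λ κ → isProper G κ ∧ hasType κ α) (allFuns n k)

ℕtoℚ : ℕ → ℚ
ℕtoℚ a = (+ a) / 1

sumℚ : List ℚ → ℚ
sumℚ = foldr _+ℚ_ 0ℚ

-- A finite formal ℚ-linear combination Σ c · X_{P_λ}, given as a list of
-- pairs (λ , c).
LinComb : Set
LinComb = List (List ℕ × ℚ)

-- X_G = Σ_{(λ,c) ∈ A} c · X_{P_λ}, with every λ a partition; equality of
-- formal power series checked coefficientwise on every monomial
-- (every monomial involves only x_1, …, x_k for some k).
IsPExpansion : ∀ {n} → Graph n → LinComb → Set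
IsPExpansion G A =
  All (λ e → IsPartition (proj₁ e)) A ×
  (∀ (k : ℕ) (α : Fin k → ℕ) →
     ℕtoℚ (coeffX G k α)
       ≡ sumℚ (map (λ e → proj₂ e *ℚ ℕtoℚ (coeffX (P (proj₁ e)) k α)) A))

-- coefficient of x^ℓ in the tree polynomial Σ c · x^{ℓ(λ)}
treeCoeff : LinComb → ℕ → ℚ
treeCoeff A ℓ = sumℚ (map (λ e → if length (proj₁ e) ≡ᵇ ℓ then proj₂ e else 0ℚ) A)

-- Setting x₁ = … = x_q = 1 in X_G gives the chromatic polynomial χ_G(q), and
-- χ_{P_λ}(q) = q^ℓ(λ) (q − 1)^(|λ| − ℓ(λ)).  Taking monomials of one degree at a
-- time, an expansion X_G = Σ a_λ X_{P_λ} therefore gives, for every size M,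
-- Σ_{|λ| = M} a_λ x^ℓ(λ) (x − 1)^(M − ℓ(λ)) = [M = |V(G)|] χ_G(x) at x = 1, 2, 3, ...,
-- and the polynomials x^ℓ (x − 1)^(M − ℓ), ℓ ≤ M, are linearly independent.
-- Gluing a tree with m further vertices multiplies χ by (x − 1)^m (delete its
-- leaves one at a time), which is exactly what replacing each λ by a partition
-- of size |λ| + m with the same number of parts does.  So for every size and
-- number of parts the coefficients of G and of H agree after this shift, and
-- summing over sizes gives τ_G = τ_H.

module Submission where

open import Defs
open import Algebra.Bundles using (CommutativeSemiring)
open import Data.Bool using (Bool; true; false; _∧_; _∨_; not; if_then_else_)
open import Data.Bool.ListAction using (all)
open import Data.Empty using (⊥-elim)
open import Data.Fin using (Fin; zero; suc; toℕ; _≟_; punchIn)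
open import Data.List using (List; []; _∷_; _++_; [_]; map; concatMap; allFin; length)
open import Data.List.Relation.Unary.All as All using (All; []; _∷_)
open import Data.Nat using (ℕ; zero; suc; _∸_; _≤_; _<_; z≤n; s≤s; _≡ᵇ_)
open import Data.Product using (Σ; ∃; _×_; _,_; proj₁; proj₂)
open import Data.Sum using (_⊎_; inj₁; inj₂)
open import Data.Vec.Functional using (insertAt) renaming (_∷_ to _∷ᶠ_; _++_ to _++ᶠ_)
open import Data.Vec.Functional.Properties using (insertAt-lookup; insertAt-punchIn)
open import Function using (_∘_; id)
open import Relation.Nullary using (¬_; yes; no)
open import Relation.Nullary.Decidable using (⌊_⌋)
open import Relation.Binary.PropositionalEquality using (_≡_; _≢_; _≗_; refl; sym; trans; cong; cong₂; subst; module ≡-Reasoning)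

module ListSum {c ℓ} (R : CommutativeSemiring c ℓ) where

  open import Algebra.Properties.CommutativeSemigroup using (interchange)
  open import Data.List using (foldr)
  open import Data.List.Properties using (map-++)

  open CommutativeSemiring R renaming (refl to ≈-refl; sym to ≈-sym; trans to ≈-trans)

  sum : List Carrier → Carrier
  sum = foldr _+_ 0#

  sum-cong-All : ∀ {A : Set} {f g : A → Carrier} {xs} → All (λ x → f x ≈ g x) xs → sum (map f xs) ≈ sum (map g xs)
  sum-cong-All []         = ≈-refl
  sum-cong-All (e ∷ es) = +-cong e (sum-cong-All es)

  sum-cong : ∀ {A : Set} {f g : A → Carrier} → (∀ x → f x ≈ g x) → ∀ xs → sum (map f xs) ≈ sum (map g xs)
  sum-cong f≈g xs = sum-cong-All (All.universal f≈g xs)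

  sum-zero : ∀ {A : Set} {f : A → Carrier} → (∀ x → f x ≈ 0#) → ∀ xs → sum (map f xs) ≈ 0#
  sum-zero f≈0 []       = ≈-refl
  sum-zero f≈0 (x ∷ xs) = ≈-trans (+-cong (f≈0 x) (sum-zero f≈0 xs)) (+-identityˡ 0#)

  sum-+ : ∀ {A : Set} (f g : A → Carrier) xs → sum (map (λ x → f x + g x) xs) ≈ sum (map f xs) + sum (map g xs)
  sum-+ f g []       = ≈-sym (+-identityˡ 0#)
  sum-+ f g (x ∷ xs) = ≈-trans (+-congˡ (sum-+ f g xs)) (interchange +-commutativeSemigroup _ _ _ _)

  sum-*ˡ : ∀ {A : Set} a (f : A → Carrier) xs → sum (map (λ x → a * f x) xs) ≈ a * sum (map f xs)
  sum-*ˡ a f []       = ≈-sym (zeroʳ a)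
  sum-*ˡ a f (x ∷ xs) = ≈-trans (+-congˡ (sum-*ˡ a f xs)) (≈-sym (distribˡ a _ _))

  sum-swap : ∀ {A B : Set} (h : A → B → Carrier) xs ys →
    sum (map (λ x → sum (map (h x) ys)) xs) ≈ sum (map (λ y → sum (map (λ x → h x y) xs)) ys)
  sum-swap h []       ys = ≈-sym (sum-zero (λ _ → ≈-refl) ys)
  sum-swap h (x ∷ xs) ys = ≈-trans (+-congˡ (sum-swap h xs ys)) (≈-sym (sum-+ (h x) _ ys))

  sum-++ : ∀ xs ys → sum (xs ++ ys) ≈ sum xs + sum ys
  sum-++ []       ys = ≈-sym (+-identityˡ _)
  sum-++ (x ∷ xs) ys = ≈-trans (+-congˡ (sum-++ xs ys)) (≈-sym (+-assoc x _ _))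

  sum-concatMap : ∀ {A B : Set} (f : B → Carrier) (k : A → List B) xs →
    sum (map f (concatMap k xs)) ≈ sum (map (sum ∘ map f ∘ k) xs)
  sum-concatMap f k []       = ≈-refl
  sum-concatMap f k (x ∷ xs) = ≈-trans (reflexive (cong sum (map-++ f (k x) (concatMap k xs))))
    (≈-trans (sum-++ (map f (k x)) _) (+-congˡ (sum-concatMap f k xs)))

module Counting where

  open import Data.Nat using (_+_; _*_)
  open import Data.Nat.Properties
    using (+-*-commutativeSemiring; +-commutativeSemigroup; ≡ᵇ⇒≡; ≡⇒≡ᵇ
          ; +-identityʳ; +-suc; *-suc; *-zeroʳ; m+n∸m≡n; n≤1+n; ≤-trans)
  open import Algebra.Properties.CommutativeSemigroup +-commutativeSemigroup using (x∙yz≈y∙xz)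
  open import Data.Fin using (splitAt)
  open import Data.Fin.Properties using (suc-injective)
  open import Data.Bool.ListAction using (and)
  open import Data.Bool.Properties using (∧-conicalˡ; ∧-conicalʳ; T-≡)
  open import Function.Bundles using (Equivalence)
  open import Data.List.Properties using (map-tabulate; length-tabulate; map-∘)
  open import Data.List.Membership.Propositional using (_∈_)
  open import Data.List.Membership.Propositional.Properties using (∈-allFin)
  open import Data.List.Relation.Unary.Any using (here; there)
  open ListSum +-*-commutativeSemiring using (sum-cong; sum-zero; sum-swap; sum-concatMap)

  bool-ext : ∀ {a b : Bool} → (a ≡ true → b ≡ true) → (b ≡ true → a ≡ true) → a ≡ b
  bool-ext {false} {false} _ _ = refl
  bool-ext {false} {true}  _ g = g refl
  bool-ext {true}  {false} f _ = sym (f refl)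
  bool-ext {true}  {true}  _ _ = refl

  ≡false⇒≢true : ∀ {b : Bool} → b ≡ false → b ≢ true
  ≡false⇒≢true refl ()

  ∧-elim : ∀ {a b : Bool} → a ∧ b ≡ true → a ≡ true × b ≡ true
  ∧-elim {a} {b} e = ∧-conicalˡ a b e , ∧-conicalʳ a b e

  ∧-intro : ∀ {a b : Bool} → a ≡ true → b ≡ true → a ∧ b ≡ true
  ∧-intro refl refl = refl

  not-elim : ∀ {a : Bool} → not a ≡ true → a ≢ true
  not-elim {true} ()

  not-intro : ∀ {a : Bool} → a ≢ true → not a ≡ true
  not-intro {false} _  = refl
  not-intro {true}  ¬a = ⊥-elim (¬a refl)

  ≟⇒≡ : ∀ {n} {i j : Fin n} → ⌊ i ≟ j ⌋ ≡ true → i ≡ j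
  ≟⇒≡ {i = i} {j} e with i ≟ j
  ... | yes i≡j = i≡j

  ≡⇒≟ : ∀ {n} {i j : Fin n} → i ≡ j → ⌊ i ≟ j ⌋ ≡ true
  ≡⇒≟ {i = i} {j} i≡j with i ≟ j
  ... | yes _  = refl
  ... | no i≢j = ⊥-elim (i≢j i≡j)

  ≡ᵇ-true⇒≡ : ∀ {m n} → (m ≡ᵇ n) ≡ true → m ≡ n
  ≡ᵇ-true⇒≡ {m} {n} e = ≡ᵇ⇒≡ m n (Equivalence.from T-≡ e)

  ≡⇒≡ᵇ-true : ∀ {m n} → m ≡ n → (m ≡ᵇ n) ≡ true
  ≡⇒≡ᵇ-true {m} {n} m≡n = Equivalence.to T-≡ (≡⇒≡ᵇ m n m≡n)

  ≟-sym : ∀ {n} (i j : Fin n) → ⌊ i ≟ j ⌋ ≡ ⌊ j ≟ i ⌋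
  ≟-sym i j = bool-ext (λ e → ≡⇒≟ (sym (≟⇒≡ e))) (λ e → ≡⇒≟ (sym (≟⇒≡ e)))

  all-sound : ∀ {A : Set} (p : A → Bool) {xs} → all p xs ≡ true → ∀ {x} → x ∈ xs → p x ≡ true
  all-sound p e (here refl) = proj₁ (∧-elim e)
  all-sound p e (there x∈) = all-sound p (proj₂ (∧-elim {p _} e)) x∈

  all-complete : ∀ {A : Set} (p : A → Bool) xs → (∀ {x} → x ∈ xs → p x ≡ true) → all p xs ≡ true
  all-complete p []       _ = refl
  all-complete p (x ∷ xs) h = ∧-intro (h (here refl)) (all-complete p xs (h ∘ there))

  allFin-sound : ∀ {n} (p : Fin n → Bool) → all p (allFin n) ≡ true → ∀ i → p i ≡ true
  allFin-sound p e i = all-sound p e (∈-allFin i)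

  allFin-complete : ∀ {n} (p : Fin n → Bool) → (∀ i → p i ≡ true) → all p (allFin n) ≡ true
  allFin-complete {n} p h = all-complete p (allFin n) (λ {i} _ → h i)

  countB-cong : ∀ {A : Set} {p r : A → Bool} → (∀ x → p x ≡ r x) → ∀ xs → countB p xs ≡ countB r xs
  countB-cong p≡r []                       = refl
  countB-cong {r = r} p≡r (x ∷ xs) rewrite p≡r x with r x
  ... | true  = cong suc (countB-cong p≡r xs)
  ... | false = countB-cong p≡r xs

  countB-map : ∀ {A B : Set} (p : B → Bool) (f : A → B) xs → countB p (map f xs) ≡ countB (p ∘ f) xs
  countB-map p f []       = refl
  countB-map p f (x ∷ xs) with p (f x)
  ... | true  = cong suc (countB-map p f xs)
  ... | false = countB-map p f xs

  countB-++ : ∀ {A : Set} (p : A → Bool) xs ys → countB p (xs ++ ys) ≡ countB p xs + countB p ys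
  countB-++ p []       ys = refl
  countB-++ p (x ∷ xs) ys with p x
  ... | true  = cong suc (countB-++ p xs ys)
  ... | false = countB-++ p xs ys

  countB-concatMap : ∀ {A B : Set} (p : B → Bool) (f : A → List B) xs →
    countB p (concatMap f xs) ≡ sumℕ (map (countB p ∘ f) xs)
  countB-concatMap p f []       = refl
  countB-concatMap p f (x ∷ xs) = trans (countB-++ p (f x) _) (cong (countB p (f x) +_) (countB-concatMap p f xs))

  countB-none : ∀ {A : Set} (p : A → Bool) → (∀ x → p x ≡ false) → ∀ xs → countB p xs ≡ 0
  countB-none p p≡false []       = refl
  countB-none p p≡false (x ∷ xs) rewrite p≡false x = countB-none p p≡false xs

  countB-all : ∀ {A : Set} (xs : List A) → countB (λ _ → true) xs ≡ length xs
  countB-all []       = refl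
  countB-all (x ∷ xs) = cong suc (countB-all xs)

  countB-≤ : ∀ {A : Set} (p : A → Bool) xs → countB p xs ≤ length xs
  countB-≤ p []       = z≤n
  countB-≤ p (x ∷ xs) with p x
  ... | true  = s≤s (countB-≤ p xs)
  ... | false = ≤-trans (countB-≤ p xs) (n≤1+n _)

  countB-+-countB-not : ∀ {A : Set} (p : A → Bool) xs → countB p xs + countB (not ∘ p) xs ≡ length xs
  countB-+-countB-not p []       = refl
  countB-+-countB-not p (x ∷ xs) with p x
  ... | true  = cong suc (countB-+-countB-not p xs)
  ... | false = trans (+-suc _ _) (cong suc (countB-+-countB-not p xs))

  countB-∧ˡ : ∀ {A : Set} b (p : A → Bool) xs → countB (λ x → b ∧ p x) xs ≡ (if b then countB p xs else 0)
  countB-∧ˡ true  p xs = refl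
  countB-∧ˡ false p xs = countB-none _ (λ _ → refl) xs

  sum-if-const : ∀ {A : Set} (b : A → Bool) k xs → sumℕ (map (λ x → if b x then k else 0) xs) ≡ countB b xs * k
  sum-if-const b k []       = refl
  sum-if-const b k (x ∷ xs) with b x
  ... | true  = cong (k +_) (sum-if-const b k xs)
  ... | false = sum-if-const b k xs

  double-count : ∀ {A D : Set} (p : A → Bool) (r : D → A → Bool) ds xs k →
    (∀ x → p x ≡ true → countB (λ d → r d x) ds ≡ k) →
    sumℕ (map (λ d → countB (λ x → p x ∧ r d x) xs) ds) ≡ k * countB p xs
  double-count p r ds []       k regular = trans (sum-zero (λ _ → refl) ds) (sym (*-zeroʳ k))
  double-count p r ds (x ∷ xs) k regular with p x in px
  ... | false = double-count p r ds xs k regular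
  ... | true  = begin
      sumℕ (map (λ d → if r d x then suc (rest d) else rest d) ds)
    ≡⟨ split-off ds ⟩
      countB (λ d → r d x) ds + sumℕ (map rest ds)
    ≡⟨ cong₂ _+_ (regular x px) (double-count p r ds xs k regular) ⟩
      k + k * countB p xs
    ≡⟨ sym (*-suc k _) ⟩
      k * suc (countB p xs)
    ∎
    where
    open ≡-Reasoning
    rest = λ d → countB (λ x → p x ∧ r d x) xs
    split-off : ∀ ds → sumℕ (map (λ d → if r d x then suc (rest d) else rest d) ds)
                      ≡ countB (λ d → r d x) ds + sumℕ (map rest ds)
    split-off []       = refl
    split-off (d ∷ ds) with r d x
    ... | true  = cong suc (trans (cong (rest d +_) (split-off ds)) (x∙yz≈y∙xz (rest d) (countB (λ d → r d x) ds) _))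
    ... | false = trans (cong (rest d +_) (split-off ds)) (x∙yz≈y∙xz (rest d) (countB (λ d → r d x) ds) _)

  countB-allFin-suc : ∀ {q} (p : Fin (suc q) → Bool) →
    countB p (allFin (suc q)) ≡ (if p zero then suc (countB (p ∘ suc) (allFin q)) else countB (p ∘ suc) (allFin q))
  countB-allFin-suc {q} p = cong (λ k → if p zero then suc k else k)
    (trans (cong (countB p) (sym (map-tabulate id suc))) (countB-map p suc (allFin q)))

  count-≟ : ∀ q (c : Fin q) → countB (λ d → ⌊ d ≟ c ⌋) (allFin q) ≡ 1
  count-≟ (suc q) zero    = trans (countB-allFin-suc {q} (λ d → ⌊ d ≟ zero ⌋)) (cong suc (countB-none _ (λ _ → refl) (allFin q)))
  count-≟ (suc q) (suc c) = trans (countB-allFin-suc {q} (λ d → ⌊ d ≟ suc c ⌋))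
    (trans (countB-cong (λ d → bool-ext (λ e → ≡⇒≟ (suc-injective (≟⇒≡ e))) (λ e → ≡⇒≟ (cong suc (≟⇒≡ e)))) (allFin q)) (count-≟ q c))

  count-≟′ : ∀ q (c : Fin q) → countB (λ d → ⌊ c ≟ d ⌋) (allFin q) ≡ 1
  count-≟′ q c = trans (countB-cong (λ d → ≟-sym c d) (allFin q)) (count-≟ q c)

  count-≢ : ∀ q (c : Fin q) → countB (λ d → not ⌊ d ≟ c ⌋) (allFin q) ≡ q ∸ 1
  count-≢ q c = begin
      countB (λ d → not ⌊ d ≟ c ⌋) (allFin q)
    ≡⟨ sym (m+n∸m≡n 1 _) ⟩
      1 + countB (λ d → not ⌊ d ≟ c ⌋) (allFin q) ∸ 1
    ≡⟨ cong (λ k → k + countB (λ d → not ⌊ d ≟ c ⌋) (allFin q) ∸ 1) (sym (count-≟ q c)) ⟩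
      countB (λ d → ⌊ d ≟ c ⌋) (allFin q) + countB (λ d → not ⌊ d ≟ c ⌋) (allFin q) ∸ 1
    ≡⟨ cong (_∸ 1) (trans (countB-+-countB-not (λ d → ⌊ d ≟ c ⌋) (allFin q)) (length-tabulate {n = q} id)) ⟩
      q ∸ 1
    ∎
    where open ≡-Reasoning

  sum-δ : ∀ q (c : Fin q) (h : Fin q → ℕ) → sumℕ (map (λ d → if ⌊ d ≟ c ⌋ then h d else 0) (allFin q)) ≡ h c
  sum-δ q c h = begin
      sumℕ (map (λ d → if ⌊ d ≟ c ⌋ then h d else 0) (allFin q))
    ≡⟨ sum-cong at-c (allFin q) ⟩
      sumℕ (map (λ d → if ⌊ d ≟ c ⌋ then h c else 0) (allFin q))
    ≡⟨ sum-if-const _ (h c) (allFin q) ⟩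
      countB (λ d → ⌊ d ≟ c ⌋) (allFin q) * h c
    ≡⟨ trans (cong (_* h c) (count-≟ q c)) (+-identityʳ (h c)) ⟩
      h c
    ∎
    where
    open ≡-Reasoning
    at-c : ∀ d → (if ⌊ d ≟ c ⌋ then h d else 0) ≡ (if ⌊ d ≟ c ⌋ then h c else 0)
    at-c d with d ≟ c
    ... | yes refl = refl
    ... | no _     = refl

  countMaps : ∀ n q → ((Fin n → Fin q) → Bool) → ℕ
  countMaps n q p = countB p (allFuns n q)

  Extensional : ∀ {n q} → ((Fin n → Fin q) → Bool) → Set
  Extensional p = ∀ {f g} → f ≗ g → p f ≡ p g

  countMaps-cong : ∀ n q {p r : (Fin n → Fin q) → Bool} → (∀ f → p f ≡ r f) → countMaps n q p ≡ countMaps n q r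
  countMaps-cong n q p≡r = countB-cong p≡r (allFuns n q)

  countMaps-∷ : ∀ n q (p : (Fin (suc n) → Fin q) → Bool) →
    countMaps (suc n) q p ≡ sumℕ (map (λ c → countMaps n q (λ f → p (c ∷ᶠ f))) (allFin q))
  countMaps-∷ n q p = trans (countB-concatMap p _ (allFin q)) (sum-cong (λ c → countB-map p (c ∷ᶠ_) (allFuns n q)) (allFin q))

  countMaps-insertAt : ∀ n q (u : Fin (suc n)) (p : (Fin (suc n) → Fin q) → Bool) → Extensional p →
    countMaps (suc n) q p ≡ sumℕ (map (λ c → countMaps n q (λ f → p (insertAt f u c))) (allFin q))
  countMaps-insertAt n q zero p ext =
    trans (countMaps-∷ n q p) (sum-cong (λ c → countMaps-cong n q (λ f → ext (λ { zero → refl ; (suc i) → refl }))) (allFin q))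
  countMaps-insertAt (suc n) q (suc u) p ext = begin
      countMaps (suc (suc n)) q p
    ≡⟨ countMaps-∷ (suc n) q p ⟩
      sumℕ (map (λ c → countMaps (suc n) q (λ f → p (c ∷ᶠ f))) (allFin q))
    ≡⟨ sum-cong (λ c → countMaps-insertAt n q u (λ f → p (c ∷ᶠ f)) (λ f≗g → ext (λ { zero → refl ; (suc i) → f≗g i }))) (allFin q) ⟩
      sumℕ (map (λ c → sumℕ (map (λ d → countMaps n q (λ f → p (c ∷ᶠ insertAt f u d))) (allFin q))) (allFin q))
    ≡⟨ sum-swap (λ c d → countMaps n q (λ f → p (c ∷ᶠ insertAt f u d))) (allFin q) (allFin q) ⟩
      sumℕ (map (λ d → sumℕ (map (λ c → countMaps n q (λ f → p (c ∷ᶠ insertAt f u d))) (allFin q))) (allFin q))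
    ≡⟨ sum-cong (λ d → trans (sum-cong (λ c → countMaps-cong n q (λ f → ext (λ { zero → refl ; (suc i) → refl }))) (allFin q))
                              (sym (countMaps-∷ n q (λ f → p (insertAt f (suc u) d))))) (allFin q) ⟩
      sumℕ (map (λ d → countMaps (suc n) q (λ f → p (insertAt f (suc u) d))) (allFin q))
    ∎
    where open ≡-Reasoning

  countMaps-++ : ∀ m n q (p : (Fin (m + n) → Fin q) → Bool) → Extensional p →
    countMaps (m + n) q p ≡ sumℕ (map (λ f → countMaps n q (λ g → p (f ++ᶠ g))) (allFuns m q))
  countMaps-++ zero    n q p ext = sym (trans (+-identityʳ _) (countMaps-cong n q (λ g → ext (λ _ → refl))))
  countMaps-++ (suc m) n q p ext = begin
      countMaps (suc m + n) q p
    ≡⟨ countMaps-∷ (m + n) q p ⟩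
      sumℕ (map (λ c → countMaps (m + n) q (λ f → p (c ∷ᶠ f))) (allFin q))
    ≡⟨ sum-cong (λ c → countMaps-++ m n q (λ f → p (c ∷ᶠ f)) (λ f≗g → ext (λ { zero → refl ; (suc i) → f≗g i }))) (allFin q) ⟩
      sumℕ (map (λ c → sumℕ (map (λ f → countMaps n q (λ g → p (c ∷ᶠ (f ++ᶠ g)))) (allFuns m q))) (allFin q))
    ≡⟨ sum-cong (λ c → trans (sum-cong (λ f → countMaps-cong n q (λ g → ext (sym ∘ ∷-++ c f g))) (allFuns m q))
                              (cong sumℕ (map-∘ (allFuns m q)))) (allFin q) ⟩
      sumℕ (map (λ c → sumℕ (map h (map (c ∷ᶠ_) (allFuns m q)))) (allFin q))
    ≡⟨ sym (sum-concatMap h (λ c → map (c ∷ᶠ_) (allFuns m q)) (allFin q)) ⟩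
      sumℕ (map h (allFuns (suc m) q))
    ∎
    where
    open ≡-Reasoning
    h = λ f → countMaps n q (λ g → p (f ++ᶠ g))
    ∷-++ : ∀ {m n q} (c : Fin q) (f : Fin m → Fin q) (g : Fin n → Fin q) → ((c ∷ᶠ f) ++ᶠ g) ≗ (c ∷ᶠ (f ++ᶠ g))
    ∷-++ c f g zero = refl
    ∷-++ {m} c f g (suc i) with splitAt m i
    ... | inj₁ _ = refl
    ... | inj₂ _ = refl

  countMaps-≗ : ∀ n q (g : Fin n → Fin q) → countMaps n q (λ f → all (λ i → ⌊ f i ≟ g i ⌋) (allFin n)) ≡ 1
  countMaps-≗ zero    q g = refl
  countMaps-≗ (suc n) q g = begin
      countMaps (suc n) q (λ f → all (λ i → ⌊ f i ≟ g i ⌋) (allFin (suc n)))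
    ≡⟨ countMaps-∷ n q _ ⟩
      sumℕ (map (λ c → countMaps n q (λ f → all (λ i → ⌊ (c ∷ᶠ f) i ≟ g i ⌋) (allFin (suc n)))) (allFin q))
    ≡⟨ sum-cong (λ c → trans (countMaps-cong n q (λ f → head-tail c f)) (countB-∧ˡ ⌊ c ≟ g zero ⌋ _ (allFuns n q))) (allFin q) ⟩
      sumℕ (map (λ c → if ⌊ c ≟ g zero ⌋ then countMaps n q (λ f → all (λ i → ⌊ f i ≟ g (suc i) ⌋) (allFin n)) else 0) (allFin q))
    ≡⟨ sum-δ q (g zero) _ ⟩
      countMaps n q (λ f → all (λ i → ⌊ f i ≟ g (suc i) ⌋) (allFin n))
    ≡⟨ countMaps-≗ n q (g ∘ suc) ⟩
      1
    ∎
    where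
    open ≡-Reasoning
    head-tail : ∀ c f → all (λ i → ⌊ (c ∷ᶠ f) i ≟ g i ⌋) (allFin (suc n))
                      ≡ ⌊ c ≟ g zero ⌋ ∧ all (λ i → ⌊ f i ≟ g (suc i) ⌋) (allFin n)
    head-tail c f = cong (λ bs → ⌊ c ≟ g zero ⌋ ∧ and bs)
      (trans (map-tabulate suc (λ i → ⌊ (c ∷ᶠ f) i ≟ g i ⌋)) (sym (map-tabulate id (λ i → ⌊ f i ≟ g (suc i) ⌋))))

module Colourings where

  open Counting
  open import Data.Fin using (splitAt; punchOut; _↑ˡ_; _↑ʳ_)
  open import Data.Fin.Properties using (splitAt-↑ˡ; splitAt-↑ʳ; punchIn-punchOut; punchIn-injective)
  open import Data.Vec.Functional.Properties using (lookup-++ˡ; lookup-++ʳ)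

  Proper : ∀ {n q} → Graph n → (Fin n → Fin q) → Set
  Proper G κ = ∀ i j → Adj G i j → κ i ≢ κ j

  isProper⇒Proper : ∀ {n q} (G : Graph n) {κ : Fin n → Fin q} → isProper G κ ≡ true → Proper G κ
  isProper⇒Proper {n} G {κ} e i j ij κi≡κj =
    not-elim (allFin-sound _ (allFin-sound (λ i → all (λ j → not (G i j ∧ ⌊ κ i ≟ κ j ⌋)) (allFin n)) e i) j)
             (∧-intro ij (≡⇒≟ κi≡κj))

  Proper⇒isProper : ∀ {n q} (G : Graph n) {κ : Fin n → Fin q} → Proper G κ → isProper G κ ≡ true
  Proper⇒isProper {n} G {κ} proper = allFin-complete _ λ i → allFin-complete _ λ j →
    not-intro λ e → proper i j (proj₁ (∧-elim e)) (≟⇒≡ (proj₂ (∧-elim {G i j} e)))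

  isProper-≡ : ∀ {n q} (G : Graph n) {κ : Fin n → Fin q} {b : Bool} →
    (Proper G κ → b ≡ true) → (b ≡ true → Proper G κ) → isProper G κ ≡ b
  isProper-≡ G to from = bool-ext (to ∘ isProper⇒Proper G) (Proper⇒isProper G ∘ from)

  isProper-extensional : ∀ {n q} (G : Graph n) → Extensional {n} {q} (isProper G)
  isProper-extensional G f≗g = bool-ext
    (λ e → Proper⇒isProper G λ i j ij eq → isProper⇒Proper G e i j ij (trans (f≗g i) (trans eq (sym (f≗g j)))))
    (λ e → Proper⇒isProper G λ i j ij eq → isProper⇒Proper G e i j ij (trans (sym (f≗g i)) (trans eq (f≗g j))))

  punchIn-cases : ∀ {n} (u i : Fin (suc n)) → i ≡ u ⊎ Σ (Fin n) (λ a → punchIn u a ≡ i)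
  punchIn-cases u i with i ≟ u
  ... | yes i≡u = inj₁ i≡u
  ... | no  i≢u = inj₂ (punchOut (i≢u ∘ sym) , punchIn-punchOut (i≢u ∘ sym))

  Proper-pullback : ∀ {m n q} {G : Graph n} {H : Graph m} {κ : Fin n → Fin q} {f : Fin m → Fin q}
    (φ : Fin m → Fin n) → (∀ a b → Adj H a b → Adj G (φ a) (φ b)) → (∀ a → f a ≡ κ (φ a)) → Proper G κ → Proper H f
  Proper-pullback φ hom f≡κ∘φ proper a b ab fa≡fb =
    proper (φ a) (φ b) (hom a b ab) (trans (sym (f≡κ∘φ a)) (trans fa≡fb (f≡κ∘φ b)))

  module _ {m n} (G : Graph m) (H : Graph n) where

    ⊕-↑ˡ : ∀ a b → (G ⊕ H) (a ↑ˡ n) (b ↑ˡ n) ≡ G a b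
    ⊕-↑ˡ a b rewrite splitAt-↑ˡ m a n | splitAt-↑ˡ m b n = refl

    ⊕-↑ʳ : ∀ a b → (G ⊕ H) (m ↑ʳ a) (m ↑ʳ b) ≡ H a b
    ⊕-↑ʳ a b rewrite splitAt-↑ʳ m n a | splitAt-↑ʳ m n b = refl

    isProper-⊕ : ∀ {q} (f : Fin m → Fin q) (g : Fin n → Fin q) →
      isProper (G ⊕ H) (f ++ᶠ g) ≡ isProper G f ∧ isProper H g
    isProper-⊕ f g = isProper-≡ (G ⊕ H) to from
      where
      to : Proper (G ⊕ H) (f ++ᶠ g) → isProper G f ∧ isProper H g ≡ true
      to proper = ∧-intro
        (Proper⇒isProper G (Proper-pullback (_↑ˡ n) (λ a b → trans (⊕-↑ˡ a b)) (sym ∘ lookup-++ˡ f g) proper))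
        (Proper⇒isProper H (Proper-pullback (m ↑ʳ_) (λ a b → trans (⊕-↑ʳ a b)) (sym ∘ lookup-++ʳ f g) proper))
      from : isProper G f ∧ isProper H g ≡ true → Proper (G ⊕ H) (f ++ᶠ g)
      from e i j with splitAt m i | splitAt m j
      ... | inj₁ a | inj₁ b = isProper⇒Proper G (proj₁ (∧-elim e)) a b
      ... | inj₂ a | inj₂ b = isProper⇒Proper H (proj₂ (∧-elim {isProper G f} e)) a b
      ... | inj₁ a | inj₂ b = λ ()
      ... | inj₂ a | inj₁ b = λ ()

  module _ {n m} (G : Graph n) (v : Fin n) (T : Graph (suc m)) (t : Fin (suc m)) where

    glue-↑ˡ-↑ˡ : ∀ a b → glue G v T t (a ↑ˡ m) (b ↑ˡ m) ≡ G a b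
    glue-↑ˡ-↑ˡ a b rewrite splitAt-↑ˡ n a m | splitAt-↑ˡ n b m = refl

    glue-↑ʳ-↑ʳ : ∀ a b → glue G v T t (n ↑ʳ a) (n ↑ʳ b) ≡ T (punchIn t a) (punchIn t b)
    glue-↑ʳ-↑ʳ a b rewrite splitAt-↑ʳ n m a | splitAt-↑ʳ n m b = refl

    glue-↑ˡ-↑ʳ : ∀ a b → glue G v T t (a ↑ˡ m) (n ↑ʳ b) ≡ ⌊ a ≟ v ⌋ ∧ T t (punchIn t b)
    glue-↑ˡ-↑ʳ a b rewrite splitAt-↑ˡ n a m | splitAt-↑ʳ n m b = refl

    glue-↑ʳ-↑ˡ : ∀ a b → glue G v T t (n ↑ʳ a) (b ↑ˡ m) ≡ ⌊ b ≟ v ⌋ ∧ T (punchIn t a) t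
    glue-↑ʳ-↑ˡ a b rewrite splitAt-↑ʳ n m a | splitAt-↑ˡ n b m = refl

    isProper-glue : ∀ {q} → (∀ x → T x x ≡ false) → (f : Fin n → Fin q) (g : Fin m → Fin q) →
      isProper (glue G v T t) (f ++ᶠ g) ≡ isProper G f ∧ isProper T (insertAt g t (f v))
    isProper-glue loopless f g = isProper-≡ (glue G v T t) to from
      where
      κ = f ++ᶠ g
      κT = insertAt g t (f v)
      κT-t : κT t ≡ κ (v ↑ˡ m)
      κT-t = trans (insertAt-lookup g t (f v)) (sym (lookup-++ˡ f g v))
      κT-punchIn : ∀ b → κT (punchIn t b) ≡ κ (n ↑ʳ b)
      κT-punchIn b = trans (insertAt-punchIn g t (f v) b) (sym (lookup-++ʳ f g b))
      to : Proper (glue G v T t) κ → isProper G f ∧ isProper T κT ≡ true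
      to proper = ∧-intro
        (Proper⇒isProper G (Proper-pullback (_↑ˡ m) (λ a b → trans (glue-↑ˡ-↑ˡ a b)) (sym ∘ lookup-++ˡ f g) proper))
        (Proper⇒isProper T properT)
        where
        properT : Proper T κT
        properT i j ij with punchIn-cases t i | punchIn-cases t j
        ... | inj₁ refl | inj₁ refl = ⊥-elim (≡false⇒≢true (loopless t) ij)
        ... | inj₁ refl | inj₂ (b , refl) = λ eq → proper (v ↑ˡ m) (n ↑ʳ b)
              (trans (glue-↑ˡ-↑ʳ v b) (∧-intro (≡⇒≟ refl) ij)) (trans (sym κT-t) (trans eq (κT-punchIn b)))
        ... | inj₂ (a , refl) | inj₁ refl = λ eq → proper (n ↑ʳ a) (v ↑ˡ m)
              (trans (glue-↑ʳ-↑ˡ a v) (∧-intro (≡⇒≟ refl) ij)) (trans (sym (κT-punchIn a)) (trans eq κT-t))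
        ... | inj₂ (a , refl) | inj₂ (b , refl) = λ eq → proper (n ↑ʳ a) (n ↑ʳ b)
              (trans (glue-↑ʳ-↑ʳ a b) ij) (trans (sym (κT-punchIn a)) (trans eq (κT-punchIn b)))
      from : isProper G f ∧ isProper T κT ≡ true → Proper (glue G v T t) κ
      from e = glued (isProper⇒Proper G (proj₁ (∧-elim e))) (isProper⇒Proper T (proj₂ (∧-elim {isProper G f} e)))
        where
        glued : Proper G f → Proper T κT → Proper (glue G v T t) κ
        glued properG properT i j with splitAt n i | splitAt n j
        ... | inj₁ a | inj₁ b = properG a b
        ... | inj₂ a | inj₂ b = λ ij eq → properT (punchIn t a) (punchIn t b) ij
              (trans (insertAt-punchIn g t (f v) a) (trans eq (sym (insertAt-punchIn g t (f v) b))))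
        ... | inj₁ a | inj₂ b = λ ij eq → properT t (punchIn t b) (proj₂ (∧-elim {⌊ a ≟ v ⌋} ij))
              (trans (insertAt-lookup g t (f v))
                (trans (cong f (sym (≟⇒≡ (proj₁ (∧-elim ij))))) (trans eq (sym (insertAt-punchIn g t (f v) b)))))
        ... | inj₂ a | inj₁ b = λ ij eq → properT (punchIn t a) t (proj₂ (∧-elim {⌊ b ≟ v ⌋} ij))
              (trans (insertAt-punchIn g t (f v) a)
                (trans eq (trans (cong f (≟⇒≡ (proj₁ (∧-elim ij)))) (sym (insertAt-lookup g t (f v))))))

  isProper-1 : ∀ {q} (G : Graph 1) (κ : Fin 1 → Fin q) → G zero zero ≡ false → isProper G κ ≡ true
  isProper-1 G κ loopless = Proper⇒isProper G {κ} λ { zero zero → ⊥-elim ∘ ≡false⇒≢true loopless }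

  deleteVertex : ∀ {n} → Graph (suc n) → Fin (suc n) → Graph n
  deleteVertex T u i j = T (punchIn u i) (punchIn u j)

  IsLeaf : ∀ {n} → Graph (suc n) → Fin (suc n) → Fin n → Set
  IsLeaf T u w = Adj T u (punchIn u w) × (∀ x → Adj T u x → x ≡ punchIn u w)

  isProper-insertAt-leaf : ∀ {n q} (T : Graph (suc n)) {u : Fin (suc n)} {w : Fin n} →
    SimpleGraph T → IsLeaf T u w → (f : Fin n → Fin q) (d : Fin q) →
    isProper T (insertAt f u d) ≡ isProper (deleteVertex T u) f ∧ not ⌊ d ≟ f w ⌋
  isProper-insertAt-leaf T {u} {w} (symmetric , loopless) (uw , only-w) f d = isProper-≡ T to from
    where
    κ = insertAt f u d
    κ-u : κ u ≡ d
    κ-u = insertAt-lookup f u d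
    κ-punchIn : ∀ a → κ (punchIn u a) ≡ f a
    κ-punchIn = insertAt-punchIn f u d
    to : Proper T κ → isProper (deleteVertex T u) f ∧ not ⌊ d ≟ f w ⌋ ≡ true
    to proper = ∧-intro
      (Proper⇒isProper (deleteVertex T u) (Proper-pullback (punchIn u) (λ _ _ ab → ab) (sym ∘ κ-punchIn) proper))
      (not-intro λ e → proper u (punchIn u w) uw (trans κ-u (trans (≟⇒≡ e) (sym (κ-punchIn w)))))
    from : isProper (deleteVertex T u) f ∧ not ⌊ d ≟ f w ⌋ ≡ true → Proper T κ
    from e i j ij with punchIn-cases u i | punchIn-cases u j
    ... | inj₁ refl | inj₁ refl = ⊥-elim (≡false⇒≢true (loopless u) ij)
    ... | inj₁ refl | inj₂ (b , refl) with punchIn-injective u b w (only-w _ ij)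
    ... | refl = λ eq → not-elim (proj₂ (∧-elim e)) (≡⇒≟ (trans (sym κ-u) (trans eq (κ-punchIn w))))
    from e i j ij | inj₂ (a , refl) | inj₁ refl with punchIn-injective u a w (only-w _ (trans (symmetric u _) ij))
    ... | refl = λ eq → not-elim (proj₂ (∧-elim e)) (≡⇒≟ (trans (sym κ-u) (trans (sym eq) (κ-punchIn w))))
    from e i j ij | inj₂ (a , refl) | inj₂ (b , refl) = λ eq →
      isProper⇒Proper (deleteVertex T u) (proj₁ (∧-elim e)) a b ij (trans (sym (κ-punchIn a)) (trans eq (κ-punchIn b)))

module Trees where

  open Counting
  open Colourings
  open import Data.Nat using (_+_; _≤?_)
  open import Data.Nat.Properties using (≰⇒>; <-irrefl; ≤-<-trans; +-identityʳ; +-suc; n≤1+n)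
  import Data.Bool as Bool
  open import Data.Fin.Properties using (pigeonhole; punchIn-injective; punchInᵢ≢i; any?) renaming (<⇒≢ to <⇒≢ᶠ)
  open import Data.List using (lookup)
  open import Data.List.Properties using (map-++; length-map)
  open import Data.List.Relation.Unary.All.Properties using (¬Any⇒All¬)
  open import Data.List.Relation.Unary.Linked using (Linked; [-]; _∷_)
  import Data.List.Relation.Unary.Linked.Properties as Linked
  open import Data.List.Relation.Unary.Unique.Propositional using (Unique; []; _∷_)
  import Data.List.Relation.Unary.Unique.Propositional.Properties as Unique
  open import Data.List.Membership.Propositional using (_∈_)
  open import Data.List.Membership.Propositional.Properties using (∈-lookup)
  open import Data.List.Relation.Unary.Any using (here; there)
  open import Relation.Nullary.Decidable using (_×-dec_; ¬?; decidable-stable)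

  lookup-injective : ∀ {A : Set} {xs : List A} → Unique xs → ∀ {i j} → lookup xs i ≡ lookup xs j → i ≡ j
  lookup-injective (x∉xs ∷ _)  {zero}  {zero}  _     = refl
  lookup-injective (x∉xs ∷ _)  {zero}  {suc j} x≡xⱼ  = ⊥-elim (All.lookup x∉xs (∈-lookup j) x≡xⱼ)
  lookup-injective (x∉xs ∷ _)  {suc i} {zero}  xᵢ≡x  = ⊥-elim (All.lookup x∉xs (∈-lookup i) (sym xᵢ≡x))
  lookup-injective (_ ∷ xs!)   {suc i} {suc j} xᵢ≡xⱼ = cong suc (lookup-injective xs! xᵢ≡xⱼ)

  Unique⇒length≤ : ∀ {N} {xs : List (Fin N)} → Unique xs → length xs ≤ N
  Unique⇒length≤ {N} {xs} xs! with length xs ≤? N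
  ... | yes ≤N = ≤N
  ... | no  ≰N with pigeonhole (≰⇒> ≰N) (lookup xs)
  ... | i , j , i<j , xᵢ≡xⱼ = ⊥-elim (<⇒≢ᶠ i<j (lookup-injective xs! xᵢ≡xⱼ))

  module _ {m} (T : Graph (suc m)) {u : Fin (suc m)} {w : Fin m} (tree : IsTree T) (leaf : IsLeaf T u w) where

    private
      T′ = deleteVertex T u
      symmetric = proj₁ (proj₁ tree)
      only-w = proj₂ leaf

    -- A walk between two vertices other than the leaf u can only enter u from
    -- its neighbour w and must leave it towards w again, so the detour is dropped.
    mutual
      walk-avoiding-leaf : ∀ {x y} → Walk T x y → ∀ a b → x ≡ punchIn u a → y ≡ punchIn u b → Walk T′ a b
      walk-avoiding-leaf stay a b refl y≡ = subst (Walk T′ a) (punchIn-injective u a b y≡) stay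
      walk-avoiding-leaf (step {w = z} xz rest) a b refl y≡ with punchIn-cases u z
      ... | inj₂ (c , refl) = step xz (walk-avoiding-leaf rest c b refl y≡)
      ... | inj₁ refl       = walk-from-leaf rest a b xz y≡

      walk-from-leaf : ∀ {y} → Walk T u y → ∀ a b → Adj T (punchIn u a) u → y ≡ punchIn u b → Walk T′ a b
      walk-from-leaf stay a b _ u≡ = ⊥-elim (punchInᵢ≢i u b (sym u≡))
      walk-from-leaf (step {w = z} uz rest) a b au y≡ =
        walk-avoiding-leaf rest a b (trans (only-w z uz) (sym (only-w _ (trans (symmetric u _) au)))) y≡

    deleteLeaf-isTree : IsTree T′
    deleteLeaf-isTree = simple , connected , acyclic
      where
      simple : SimpleGraph T′
      simple = (λ i j → symmetric _ _) , (λ i → proj₂ (proj₁ tree) _)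
      connected : Connected T′
      connected a b = walk-avoiding-leaf (proj₁ (proj₂ tree) (punchIn u a) (punchIn u b)) a b refl refl
      acyclic : ¬ HasCycle T′
      acyclic (x , ys , 2≤ , unique , linked) = proj₂ (proj₂ tree)
        ( punchIn u x , map (punchIn u) ys
        , subst (2 ≤_) (sym (length-map (punchIn u) ys)) 2≤
        , Unique.map⁺ (λ {a} {b} → punchIn-injective u a b) unique
        , subst (Linked (Adj T)) (cong (punchIn u x ∷_) (map-++ (punchIn u) ys [ x ])) (Linked.map⁺ linked))

  prefixTo : ∀ {A : Set} {y : A} {xs : List A} → y ∈ xs → List A
  prefixTo {xs = x ∷ _} (here _)  = [ x ]
  prefixTo {xs = x ∷ _} (there p) = x ∷ prefixTo p

  prefixTo-nonempty : ∀ {A : Set} {y : A} {xs : List A} (p : y ∈ xs) → 1 ≤ length (prefixTo p)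
  prefixTo-nonempty (here _)  = s≤s z≤n
  prefixTo-nonempty (there _) = s≤s z≤n

  prefixTo-All : ∀ {A : Set} {P : A → Set} {y : A} {xs : List A} → All P xs → (p : y ∈ xs) → All P (prefixTo p)
  prefixTo-All (px ∷ _)   (here _)  = px ∷ []
  prefixTo-All (px ∷ pxs) (there p) = px ∷ prefixTo-All pxs p

  prefixTo-Unique : ∀ {A : Set} {y : A} {xs : List A} → Unique xs → (p : y ∈ xs) → Unique (prefixTo p)
  prefixTo-Unique (_ ∷ _)       (here _)  = [] ∷ []
  prefixTo-Unique (x∉xs ∷ xs!) (there p) = prefixTo-All x∉xs p ∷ prefixTo-Unique xs! p

  prefixTo-Linked : ∀ {A : Set} {R : A → A → Set} {a y z : A} {xs : List A} →
    Linked R (a ∷ xs) → (p : y ∈ xs) → R y z → Linked R (a ∷ prefixTo p ++ [ z ])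
  prefixTo-Linked (r ∷ _)  (here refl) ryz = r ∷ ryz ∷ [-]
  prefixTo-Linked (r ∷ rs) (there p)   ryz = r ∷ prefixTo-Linked rs p ryz

  module _ {N} (T : Graph N) (tree : IsTree T) (t : Fin N) where
    open import Data.List.Membership.DecPropositional (_≟_ {N}) using (_∈?_)

    private
      symmetric = proj₁ (proj₁ tree)

    PathThrough-t : Fin N → List (Fin N) → Set
    PathThrough-t h xs = Linked (Adj T) (h ∷ xs) × Unique (h ∷ xs) × t ∈ xs

    -- Extend the path at its head h while h has a neighbour off the path;
    -- the fuel k suffices because a path has at most N vertices.
    maximal-path : ∀ k h xs → PathThrough-t h xs → N < length (h ∷ xs) + k →
      Σ (Fin N) λ h′ → Σ (List (Fin N)) λ xs′ → PathThrough-t h′ xs′ × (∀ y → Adj T h′ y → y ∈ h′ ∷ xs′)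
    maximal-path zero h xs (_ , h∷xs! , _) N< =
      ⊥-elim (<-irrefl refl (≤-<-trans (Unique⇒length≤ h∷xs!) (subst (N <_) (+-identityʳ _) N<)))
    maximal-path (suc k) h xs path@(linked , h∷xs! , t∈xs) N<
      with any? (λ y → (T h y Bool.≟ true) ×-dec ¬? (y ∈? (h ∷ xs)))
    ... | yes (y , hy , y∉) = maximal-path k y (h ∷ xs)
          (trans (symmetric y h) hy ∷ linked , ¬Any⇒All¬ (h ∷ xs) y∉ ∷ h∷xs! , there t∈xs)
          (subst (N <_) (+-suc _ k) N<)
    ... | no ∄y = h , xs , path , λ y hy → decidable-stable (y ∈? (h ∷ xs)) (λ y∉ → ∄y (y , hy , y∉))

  walk-neighbour : ∀ {n} {G : Graph n} {x y} → Walk G x y → x ≢ y → ∃ (Adj G x)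
  walk-neighbour stay               x≢x = ⊥-elim (x≢x refl)
  walk-neighbour (step {w = z} xz _) _  = z , xz

  -- The head of a maximal path through t is a leaf other than t: a second
  -- neighbour would lie further along the path and close a cycle.
  tree-has-leaf : ∀ {m} (T : Graph (suc (suc m))) → IsTree T → ∀ t →
    Σ (Fin (suc (suc m))) λ u → u ≢ t × Σ (Fin (suc m)) λ w → IsLeaf T u w
  tree-has-leaf {m} T tree@((symmetric , loopless) , connected , acyclic) t
    with walk-neighbour (connected t (punchIn t zero)) (punchInᵢ≢i t zero ∘ sym)
  ... | z , tz with maximal-path T tree t (suc (suc m)) z [ t ] start (s≤s (n≤1+n _))
    where
    start : PathThrough-t T tree t z [ t ]
    start = trans (symmetric z t) tz ∷ [-] , ((λ { refl → ≡false⇒≢true (loopless t) tz }) ∷ []) ∷ [] ∷ [] , here refl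
  ... | h , [] , (_ , _ , ()) , _
  ... | h , h′ ∷ rest , (hh′ ∷ linked , (h∉ ∷ rest!) , t∈) , maximal with punchIn-cases h h′
  ...   | inj₁ refl = ⊥-elim (All.lookup h∉ (here refl) refl)
  ...   | inj₂ (w , refl) = h , All.lookup h∉ t∈ , w , hh′ , only-neighbour
    where
    only-neighbour : ∀ x → Adj T h x → x ≡ punchIn h w
    only-neighbour x hx with maximal x hx
    ... | here refl           = ⊥-elim (≡false⇒≢true (loopless h) hx)
    ... | there (here refl)   = refl
    ... | there (there x∈rest) = ⊥-elim (acyclic
          ( h , punchIn h w ∷ prefixTo x∈rest
          , s≤s (prefixTo-nonempty x∈rest)
          , prefixTo-All h∉ (there x∈rest) ∷ prefixTo-Unique rest! (there x∈rest)
          , prefixTo-Linked (hh′ ∷ linked) (there x∈rest) (trans (symmetric x h) hx)))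

module ChromaticPolynomial where

  open Counting
  open Colourings
  open Trees
  open import Data.Nat using (_+_; _*_; _^_)
  open import Data.Nat.Properties
    using (+-*-commutativeSemiring; *-commutativeSemigroup
          ; +-identityʳ; *-identityˡ; *-identityʳ; ^-distribˡ-+-*; +-∸-assoc; +-monoˡ-≤; ≤-trans)
  open import Algebra.Properties.CommutativeSemigroup *-commutativeSemigroup using (x∙yz≈y∙xz; interchange)
  open import Algebra.Bundles using (CommutativeMonoid)
  open import Data.Bool.Properties using (∧-commutativeMonoid; ∧-identityʳ; ∧-zeroʳ; ∧-comm; ∨-comm)
  open import Algebra.Properties.CommutativeSemigroup (CommutativeMonoid.commutativeSemigroup ∧-commutativeMonoid)
    using (xy∙z≈xz∙y)
  open import Data.Fin using (fromℕ<; punchOut)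
  open import Data.Fin.Properties using (punchIn-punchOut; toℕ-injective; toℕ-fromℕ<)
  open import Data.List.Properties using (length-tabulate)
  open ListSum +-*-commutativeSemiring using (sum-cong)

  chromatic : ∀ {n} → Graph n → ℕ → ℕ
  chromatic {n} G q = countMaps n q (isProper G)

  chromatic-⊕ : ∀ {m n} (G : Graph m) (H : Graph n) q → chromatic (G ⊕ H) q ≡ chromatic G q * chromatic H q
  chromatic-⊕ {m} {n} G H q = begin
      countMaps (m + n) q (isProper (G ⊕ H))
    ≡⟨ countMaps-++ m n q (isProper (G ⊕ H)) (isProper-extensional (G ⊕ H)) ⟩
      sumℕ (map (λ f → countMaps n q (λ g → isProper (G ⊕ H) (f ++ᶠ g))) (allFuns m q))
    ≡⟨ sum-cong (λ f → trans (countMaps-cong n q (isProper-⊕ G H f)) (countB-∧ˡ (isProper G f) _ (allFuns n q))) (allFuns m q) ⟩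
      sumℕ (map (λ f → if isProper G f then chromatic H q else 0) (allFuns m q))
    ≡⟨ sum-if-const (isProper G) _ (allFuns m q) ⟩
      chromatic G q * chromatic H q
    ∎
    where open ≡-Reasoning

  -- Each proper colouring of T - u extends in q - 1 ways to the leaf u.
  countMaps-leaf : ∀ {n q} (T : Graph (suc n)) {u w} → SimpleGraph T → IsLeaf T u w →
    (r : (Fin n → Fin q) → Bool) → Extensional r →
    countMaps (suc n) q (λ κ → isProper T κ ∧ r (κ ∘ punchIn u))
    ≡ (q ∸ 1) * countMaps n q (λ f → isProper (deleteVertex T u) f ∧ r f)
  countMaps-leaf {n} {q} T {u} {w} simple leaf r r-ext = begin
      countMaps (suc n) q (λ κ → isProper T κ ∧ r (κ ∘ punchIn u))
    ≡⟨ countMaps-insertAt n q u _ (λ f≗g → cong₂ _∧_ (isProper-extensional T f≗g) (r-ext (f≗g ∘ punchIn u))) ⟩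
      sumℕ (map (λ d → countMaps n q (λ f → isProper T (insertAt f u d) ∧ r (insertAt f u d ∘ punchIn u))) (allFin q))
    ≡⟨ sum-cong (λ d → countMaps-cong n q (split-leaf d)) (allFin q) ⟩
      sumℕ (map (λ d → countMaps n q (λ f → (isProper T′ f ∧ r f) ∧ not ⌊ d ≟ f w ⌋)) (allFin q))
    ≡⟨ double-count (λ f → isProper T′ f ∧ r f) (λ d f → not ⌊ d ≟ f w ⌋) (allFin q) (allFuns n q) (q ∸ 1) (λ f _ → count-≢ q (f w)) ⟩
      (q ∸ 1) * countMaps n q (λ f → isProper T′ f ∧ r f)
    ∎
    where
    open ≡-Reasoning
    T′ = deleteVertex T u
    split-leaf : ∀ d f → (isProper T (insertAt f u d) ∧ r (insertAt f u d ∘ punchIn u))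
                       ≡ ((isProper T′ f ∧ r f) ∧ not ⌊ d ≟ f w ⌋)
    split-leaf d f = trans (cong₂ _∧_ (isProper-insertAt-leaf T simple leaf f d) (r-ext (insertAt-punchIn f u d)))
                           (xy∙z≈xz∙y (isProper T′ f) _ (r f))

  countMaps-1 : ∀ {q} (G : Graph 1) → G zero zero ≡ false → (r : Fin q → Bool) →
    countMaps 1 q (λ κ → isProper G κ ∧ r (κ zero)) ≡ countB r (allFin q)
  countMaps-1 {q} G loopless r = begin
      countMaps 1 q (λ κ → isProper G κ ∧ r (κ zero))
    ≡⟨ countMaps-∷ 0 q _ ⟩
      sumℕ (map (λ c → if isProper G (c ∷ᶠ λ ()) ∧ r c then 1 else 0) (allFin q))
    ≡⟨ sum-cong (λ c → cong (λ b → if b ∧ r c then 1 else 0) (isProper-1 G (c ∷ᶠ λ ()) loopless)) (allFin q) ⟩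
      sumℕ (map (λ c → if r c then 1 else 0) (allFin q))
    ≡⟨ trans (sum-if-const r 1 (allFin q)) (*-identityʳ _) ⟩
      countB r (allFin q)
    ∎
    where open ≡-Reasoning

  chromatic-leaf : ∀ {n} q (T : Graph (suc n)) {u w} → SimpleGraph T → IsLeaf T u w →
    chromatic T q ≡ (q ∸ 1) * chromatic (deleteVertex T u) q
  chromatic-leaf {n} q T {u} simple leaf = begin
      chromatic T q
    ≡⟨ countMaps-cong (suc n) q (λ κ → sym (∧-identityʳ (isProper T κ))) ⟩
      countMaps (suc n) q (λ κ → isProper T κ ∧ true)
    ≡⟨ countMaps-leaf {q = q} T simple leaf (λ _ → true) (λ _ → refl) ⟩
      (q ∸ 1) * countMaps n q (λ f → isProper (deleteVertex T u) f ∧ true)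
    ≡⟨ cong ((q ∸ 1) *_) (countMaps-cong n q (λ f → ∧-identityʳ (isProper (deleteVertex T u) f))) ⟩
      (q ∸ 1) * chromatic (deleteVertex T u) q
    ∎
    where open ≡-Reasoning

  chromatic-1 : ∀ q (G : Graph 1) → G zero zero ≡ false → chromatic G q ≡ q
  chromatic-1 q G loopless = begin
      chromatic G q
    ≡⟨ countMaps-cong 1 q (λ κ → sym (∧-identityʳ (isProper G κ))) ⟩
      countMaps 1 q (λ κ → isProper G κ ∧ true)
    ≡⟨ countMaps-1 {q} G loopless (λ _ → true) ⟩
      countB (λ _ → true) (allFin q)
    ≡⟨ trans (countB-all (allFin q)) (length-tabulate {n = q} id) ⟩
      q
    ∎
    where open ≡-Reasoning

  1+n≡ᵇn : ∀ n → (suc n ≡ᵇ n) ≡ false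
  1+n≡ᵇn zero    = refl
  1+n≡ᵇn (suc n) = 1+n≡ᵇn n

  pathG-simple : ∀ k → SimpleGraph (pathG k)
  pathG-simple k = (λ i j → ∨-comm (suc (toℕ i) ≡ᵇ toℕ j) _) , (λ i → cong₂ _∨_ (1+n≡ᵇn (toℕ i)) (1+n≡ᵇn (toℕ i)))

  pathG-leaf : ∀ p → IsLeaf (pathG (suc (suc p))) zero zero
  pathG-leaf p = refl , only-1
    where
    only-1 : ∀ x → Adj (pathG (suc (suc p))) zero x → x ≡ suc zero
    only-1 (suc zero)    _ = refl
    only-1 (suc (suc _)) ()

  -- Deleting the leaf 0 of pathG (2 + p) gives pathG (1 + p) definitionally.
  chromatic-path : ∀ p q → chromatic (pathG (suc p)) q ≡ q * (q ∸ 1) ^ p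
  chromatic-path zero    q = trans (chromatic-1 q (pathG 1) refl) (sym (*-identityʳ q))
  chromatic-path (suc p) q = begin
      chromatic (pathG (suc (suc p))) q
    ≡⟨ chromatic-leaf q (pathG (suc (suc p))) (pathG-simple _) (pathG-leaf p) ⟩
      (q ∸ 1) * chromatic (pathG (suc p)) q
    ≡⟨ cong ((q ∸ 1) *_) (chromatic-path p q) ⟩
      (q ∸ 1) * (q * (q ∸ 1) ^ p)
    ≡⟨ x∙yz≈y∙xz (q ∸ 1) q _ ⟩
      q * (q ∸ 1) ^ suc p
    ∎
    where open ≡-Reasoning

  length≤sum : ∀ (λ′ : List ℕ) → All (1 ≤_) λ′ → length λ′ ≤ sumℕ λ′
  length≤sum []       []         = z≤n
  length≤sum (p ∷ ps) (1≤p ∷ ps≥1) = ≤-trans (s≤s (length≤sum ps ps≥1)) (+-monoˡ-≤ (sumℕ ps) 1≤p)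

  chromatic-P : ∀ q (λ′ : List ℕ) → All (1 ≤_) λ′ →
    chromatic (P λ′) q ≡ q ^ length λ′ * (q ∸ 1) ^ (sumℕ λ′ ∸ length λ′)
  chromatic-P q []           []         = refl
  chromatic-P q (suc p ∷ ps) (_ ∷ ps≥1) = begin
      chromatic (pathG (suc p) ⊕ P ps) q
    ≡⟨ chromatic-⊕ (pathG (suc p)) (P ps) q ⟩
      chromatic (pathG (suc p)) q * chromatic (P ps) q
    ≡⟨ cong₂ _*_ (chromatic-path p q) (chromatic-P q ps ps≥1) ⟩
      (q * (q ∸ 1) ^ p) * (q ^ length ps * (q ∸ 1) ^ (sumℕ ps ∸ length ps))
    ≡⟨ interchange q _ _ _ ⟩
      q ^ suc (length ps) * ((q ∸ 1) ^ p * (q ∸ 1) ^ (sumℕ ps ∸ length ps))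
    ≡⟨ cong (q ^ suc (length ps) *_) (sym (^-distribˡ-+-* (q ∸ 1) p _)) ⟩
      q ^ suc (length ps) * (q ∸ 1) ^ (p + (sumℕ ps ∸ length ps))
    ≡⟨ cong (λ k → q ^ suc (length ps) * (q ∸ 1) ^ k) (sym (+-∸-assoc p (length≤sum ps ps≥1))) ⟩
      q ^ suc (length ps) * (q ∸ 1) ^ (p + sumℕ ps ∸ length ps)
    ∎
    where open ≡-Reasoning

  rooted-count-tree : ∀ q m (T : Graph (suc m)) → IsTree T → ∀ t c →
    countMaps (suc m) q (λ κ → isProper T κ ∧ ⌊ κ t ≟ c ⌋) ≡ (q ∸ 1) ^ m
  rooted-count-tree q zero T tree zero c = trans (countMaps-1 T (proj₂ (proj₁ tree) zero) (λ d → ⌊ d ≟ c ⌋)) (count-≟ q c)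
  rooted-count-tree q (suc m) T tree t c with tree-has-leaf T tree t
  ... | u , u≢t , w , leaf = begin
      countMaps (suc (suc m)) q (λ κ → isProper T κ ∧ ⌊ κ t ≟ c ⌋)
    ≡⟨ countMaps-cong (suc (suc m)) q (λ κ → cong (λ i → isProper T κ ∧ ⌊ κ i ≟ c ⌋) (sym (punchIn-punchOut u≢t))) ⟩
      countMaps (suc (suc m)) q (λ κ → isProper T κ ∧ ⌊ κ (punchIn u t′) ≟ c ⌋)
    ≡⟨ countMaps-leaf T (proj₁ tree) leaf (λ f → ⌊ f t′ ≟ c ⌋) (λ f≗g → cong (λ d → ⌊ d ≟ c ⌋) (f≗g t′)) ⟩
      (q ∸ 1) * countMaps (suc m) q (λ f → isProper (deleteVertex T u) f ∧ ⌊ f t′ ≟ c ⌋)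
    ≡⟨ cong ((q ∸ 1) *_) (rooted-count-tree q m (deleteVertex T u) (deleteLeaf-isTree T tree leaf) t′ c) ⟩
      (q ∸ 1) ^ suc m
    ∎
    where
    open ≡-Reasoning
    t′ = punchOut u≢t

  extensions-tree : ∀ q m (T : Graph (suc m)) → IsTree T → ∀ t c →
    countMaps m q (λ g → isProper T (insertAt g t c)) ≡ (q ∸ 1) ^ m
  extensions-tree q m T tree t c = begin
      countMaps m q (λ g → isProper T (insertAt g t c))
    ≡⟨ sym (sum-δ q c (λ d → countMaps m q (λ g → isProper T (insertAt g t d)))) ⟩
      sumℕ (map (λ d → if ⌊ d ≟ c ⌋ then countMaps m q (λ g → isProper T (insertAt g t d)) else 0) (allFin q))
    ≡⟨ sum-cong (λ d → sym (trans (countMaps-cong m q (colour-of-t d)) (countB-∧ˡ ⌊ d ≟ c ⌋ _ (allFuns m q)))) (allFin q) ⟩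
      sumℕ (map (λ d → countMaps m q (λ g → isProper T (insertAt g t d) ∧ ⌊ insertAt g t d t ≟ c ⌋)) (allFin q))
    ≡⟨ sym (countMaps-insertAt m q t _ (λ f≗g → cong₂ _∧_ (isProper-extensional T f≗g) (cong (λ d → ⌊ d ≟ c ⌋) (f≗g t)))) ⟩
      countMaps (suc m) q (λ κ → isProper T κ ∧ ⌊ κ t ≟ c ⌋)
    ≡⟨ rooted-count-tree q m T tree t c ⟩
      (q ∸ 1) ^ m
    ∎
    where
    open ≡-Reasoning
    colour-of-t : ∀ d g → (isProper T (insertAt g t d) ∧ ⌊ insertAt g t d t ≟ c ⌋) ≡ ⌊ d ≟ c ⌋ ∧ isProper T (insertAt g t d)
    colour-of-t d g = trans (cong (λ e → isProper T (insertAt g t d) ∧ ⌊ e ≟ c ⌋) (insertAt-lookup g t d))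
                            (∧-comm (isProper T (insertAt g t d)) _)

  chromatic-glue : ∀ q {n m} (G : Graph n) (v : Fin n) (T : Graph (suc m)) (t : Fin (suc m)) → IsTree T →
    chromatic (glue G v T t) q ≡ chromatic G q * (q ∸ 1) ^ m
  chromatic-glue q {n} {m} G v T t tree = begin
      countMaps (n + m) q (isProper (glue G v T t))
    ≡⟨ countMaps-++ n m q _ (isProper-extensional (glue G v T t)) ⟩
      sumℕ (map (λ f → countMaps m q (λ g → isProper (glue G v T t) (f ++ᶠ g))) (allFuns n q))
    ≡⟨ sum-cong (λ f → trans (countMaps-cong m q (isProper-glue G v T t (proj₂ (proj₁ tree)) f))
                             (countB-∧ˡ (isProper G f) _ (allFuns m q))) (allFuns n q) ⟩
      sumℕ (map (λ f → if isProper G f then countMaps m q (λ g → isProper T (insertAt g t (f v))) else 0) (allFuns n q))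
    ≡⟨ sum-cong (λ f → cong (λ k → if isProper G f then k else 0) (extensions-tree q m T tree t (f v))) (allFuns n q) ⟩
      sumℕ (map (λ f → if isProper G f then (q ∸ 1) ^ m else 0) (allFuns n q))
    ≡⟨ sum-if-const (isProper G) _ (allFuns n q) ⟩
      chromatic G q * (q ∸ 1) ^ m
    ∎
    where open ≡-Reasoning

  exponentsUpTo : ∀ q M → List (Fin q → ℕ)
  exponentsUpTo q M = map (λ f c → toℕ (f c)) (allFuns q (suc M))

  degree : ∀ {q} → (Fin q → ℕ) → ℕ
  degree {q} α = sumℕ (map α (allFin q))

  module _ {n q} (κ : Fin n → Fin q) where

    classSize : Fin q → ℕ
    classSize c = countB (λ i → ⌊ κ i ≟ c ⌋) (allFin n)

    hasType⇒≡classSize : ∀ α → hasType κ α ≡ true → ∀ c → α c ≡ classSize c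
    hasType⇒≡classSize α e c = sym (≡ᵇ-true⇒≡ (allFin-sound (λ c → classSize c ≡ᵇ α c) e c))

    ≡classSize⇒hasType : ∀ α → (∀ c → α c ≡ classSize c) → hasType κ α ≡ true
    ≡classSize⇒hasType α α≡ = allFin-complete (λ c → classSize c ≡ᵇ α c) (λ c → ≡⇒≡ᵇ-true (sym (α≡ c)))

    degree-classSize : degree classSize ≡ n
    degree-classSize = begin
        sumℕ (map (λ c → countB (λ i → true ∧ ⌊ κ i ≟ c ⌋) (allFin n)) (allFin q))
      ≡⟨ double-count (λ _ → true) (λ c i → ⌊ κ i ≟ c ⌋) (allFin q) (allFin n) 1 (λ i _ → count-≟′ q (κ i)) ⟩
        1 * countB (λ _ → true) (allFin n)
      ≡⟨ trans (*-identityˡ _) (trans (countB-all (allFin n)) (length-tabulate {n = n} id)) ⟩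
        n
      ∎
      where open ≡-Reasoning

    classSize≤ : ∀ c → classSize c ≤ n
    classSize≤ c = subst (classSize c ≤_) (length-tabulate {n = n} id) (countB-≤ _ (allFin n))

    -- The only exponent vector that can be counted is the type of κ itself.
    count-types : ∀ M (D : ℕ → Bool) → (∀ s → D s ≡ true → s ≤ M) →
      countB (λ α → hasType κ α ∧ D (degree α)) (exponentsUpTo q M) ≡ (if D n then 1 else 0)
    count-types M D D⇒≤M = trans (countB-map _ _ (allFuns q (suc M))) (by-cases (D n) refl)
      where
      counted : (Fin q → Fin (suc M)) → Bool
      counted f = hasType κ (toℕ ∘ f) ∧ D (degree (toℕ ∘ f))
      by-cases : ∀ b → D n ≡ b → countB counted (allFuns q (suc M)) ≡ (if b then 1 else 0)
      by-cases false Dn≡false = countB-none counted not-counted (allFuns q (suc M))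
        where
        not-counted : ∀ f → counted f ≡ false
        not-counted f with hasType κ (toℕ ∘ f) in e
        ... | false = refl
        ... | true  = trans (cong D (trans (sum-cong (hasType⇒≡classSize _ e) (allFin q)) degree-classSize)) Dn≡false
      by-cases true Dn≡true = trans (countMaps-cong q (suc M) (λ f → bool-ext to from)) (countMaps-≗ q (suc M) type)
        where
        type : Fin q → Fin (suc M)
        type c = fromℕ< (s≤s (≤-trans (classSize≤ c) (D⇒≤M n Dn≡true)))
        to : ∀ {f} → counted f ≡ true → all (λ c → ⌊ f c ≟ type c ⌋) (allFin q) ≡ true
        to {f} e = allFin-complete _ λ c → ≡⇒≟ (toℕ-injective
          (trans (hasType⇒≡classSize _ (proj₁ (∧-elim e)) c) (sym (toℕ-fromℕ< _))))
        from : ∀ {f} → all (λ c → ⌊ f c ≟ type c ⌋) (allFin q) ≡ true → counted f ≡ true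
        from {f} e = ∧-intro (≡classSize⇒hasType _ f≡) (trans (cong D (trans (sum-cong f≡ (allFin q)) degree-classSize)) Dn≡true)
          where
          f≡ : ∀ c → toℕ (f c) ≡ classSize c
          f≡ c = trans (cong toℕ (≟⇒≡ (allFin-sound _ e c))) (toℕ-fromℕ< _)

  -- Summing the coefficients of X_G over all monomials whose degree passes D
  -- counts each proper colouring once, at the monomial of its type.
  sum-coeffX-by-degree : ∀ {n} (G : Graph n) q M (D : ℕ → Bool) → (∀ s → D s ≡ true → s ≤ M) →
    sumℕ (map (λ α → if D (degree α) then coeffX G q α else 0) (exponentsUpTo q M)) ≡ (if D n then chromatic G q else 0)
  sum-coeffX-by-degree {n} G q M D D⇒≤M = begin
      sumℕ (map (λ α → if D (degree α) then coeffX G q α else 0) (exponentsUpTo q M))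
    ≡⟨ sum-cong (λ α → as-count α (D (degree α))) (exponentsUpTo q M) ⟩
      sumℕ (map (λ α → countB (λ κ → isProper G κ ∧ (hasType κ α ∧ D (degree α))) (allFuns n q)) (exponentsUpTo q M))
    ≡⟨ double-count (isProper G) (λ α κ → hasType κ α ∧ D (degree α)) (exponentsUpTo q M) (allFuns n q) _ (λ κ _ → count-types κ M D D⇒≤M) ⟩
      (if D n then 1 else 0) * chromatic G q
    ≡⟨ indicator-* (D n) ⟩
      (if D n then chromatic G q else 0)
    ∎
    where
    open ≡-Reasoning
    as-count : ∀ α b → (if b then coeffX G q α else 0) ≡ countB (λ κ → isProper G κ ∧ (hasType κ α ∧ b)) (allFuns n q)
    as-count α true  = countMaps-cong n q (λ κ → cong (isProper G κ ∧_) (sym (∧-identityʳ _)))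
    as-count α false = sym (countB-none _ (λ κ → trans (cong (isProper G κ ∧_) (∧-zeroʳ _)) (∧-zeroʳ _)) (allFuns n q))
    indicator-* : ∀ b → (if b then 1 else 0) * chromatic G q ≡ (if b then chromatic G q else 0)
    indicator-* true  = +-identityʳ _
    indicator-* false = refl

module Polynomials where

  open Counting using (≡ᵇ-true⇒≡; ≡⇒≡ᵇ-true; ≡false⇒≢true)
  open import Data.Nat using () renaming (_+_ to _+ℕ_; _*_ to _*ℕ_; _^_ to _^ℕ_)
  import Data.Nat.Properties as ℕ
  import Data.Integer as ℤ
  import Data.Integer.Properties as ℤ
  open import Data.Nat.Coprimality using (1-coprimeTo) renaming (sym to coprime-sym)
  open import Data.Rational using (ℚ; mkℚ; 0ℚ; 1ℚ; _+_; _*_; _-_; -_; _/_; 1/_)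
  import Data.Rational.Properties as ℚ
  open import Data.Rational.Solver using (module +-*-Solver)
  open +-*-Solver using (solve; _:=_; con; _:+_; _:*_; _:-_; :-_)
  open import Algebra.Bundles using (CommutativeRing)
  open import Algebra.Properties.Group ℚ.+-0-group using (x∙y⁻¹≈ε⇒x≈y; x≈y⇒x∙y⁻¹≈ε)

  ℚ-semiring : CommutativeSemiring _ _
  ℚ-semiring = CommutativeRing.commutativeSemiring ℚ.+-*-commutativeRing

  open import Algebra.Properties.Semiring.Exp (CommutativeSemiring.semiring ℚ-semiring) using (_^_)

  ℕtoℚ-mkℚ : ∀ a → ℕtoℚ a ≡ mkℚ (ℤ.+ a) 0 (coprime-sym (1-coprimeTo a))
  ℕtoℚ-mkℚ a = ℚ.normalize-coprime (coprime-sym (1-coprimeTo a))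

  ℕtoℚ-+ : ∀ a b → ℕtoℚ (a +ℕ b) ≡ ℕtoℚ a + ℕtoℚ b
  ℕtoℚ-+ a b = sym (trans (cong₂ _+_ (ℕtoℚ-mkℚ a) (ℕtoℚ-mkℚ b))
    (cong (_/ 1) (trans (cong₂ ℤ._+_ (ℤ.*-identityʳ (ℤ.+ a)) (ℤ.*-identityʳ (ℤ.+ b))) (sym (ℤ.pos-+ a b)))))

  ℕtoℚ-* : ∀ a b → ℕtoℚ (a *ℕ b) ≡ ℕtoℚ a * ℕtoℚ b
  ℕtoℚ-* a b = sym (trans (cong₂ _*_ (ℕtoℚ-mkℚ a) (ℕtoℚ-mkℚ b)) (cong (_/ 1) (sym (ℤ.pos-* a b))))

  ℕtoℚ-^ : ∀ a k → ℕtoℚ (a ^ℕ k) ≡ ℕtoℚ a ^ k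
  ℕtoℚ-^ a zero    = refl
  ℕtoℚ-^ a (suc k) = trans (ℕtoℚ-* a (a ^ℕ k)) (cong (ℕtoℚ a *_) (ℕtoℚ-^ a k))

  ℕtoℚ-sum : ∀ {A : Set} (f : A → ℕ) xs → ℕtoℚ (sumℕ (map f xs)) ≡ sumℚ (map (ℕtoℚ ∘ f) xs)
  ℕtoℚ-sum f []       = refl
  ℕtoℚ-sum f (x ∷ xs) = trans (ℕtoℚ-+ (f x) _) (cong (ℕtoℚ (f x) +_) (ℕtoℚ-sum f xs))

  ℕtoℚ-suc-1 : ∀ a → ℕtoℚ (suc a) - 1ℚ ≡ ℕtoℚ a
  ℕtoℚ-suc-1 a = trans (cong (_- 1ℚ) (ℕtoℚ-+ 1 a)) (solve 1 (λ y → (con 1ℚ :+ y) :- con 1ℚ := y) refl (ℕtoℚ a))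

  ℕtoℚ-suc-*-cancel : ∀ a {b} → ℕtoℚ (suc a) * b ≡ 0ℚ → b ≡ 0ℚ
  ℕtoℚ-suc-*-cancel a {b} ab≡0 = begin
      b                  ≡⟨ sym (ℚ.*-identityˡ b) ⟩
      1ℚ * b             ≡⟨ cong (_* b) (sym (ℚ.*-inverseˡ p)) ⟩
      (1/ p * p) * b     ≡⟨ ℚ.*-assoc (1/ p) p b ⟩
      1/ p * (p * b)     ≡⟨ cong (λ r → 1/ p * (r * b)) (sym (ℕtoℚ-mkℚ (suc a))) ⟩
      1/ p * (ℕtoℚ (suc a) * b) ≡⟨ cong (1/ p *_) ab≡0 ⟩
      1/ p * 0ℚ          ≡⟨ ℚ.*-zeroʳ (1/ p) ⟩
      0ℚ                 ∎
    where
    open ≡-Reasoning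
    p = mkℚ (ℤ.+ suc a) 0 (coprime-sym (1-coprimeTo (suc a)))

  -- f is a polynomial function of degree at most k, in Horner form.
  IsPolynomial : ℕ → (ℚ → ℚ) → Set
  IsPolynomial zero    f = Σ ℚ λ c → ∀ x → f x ≡ c
  IsPolynomial (suc k) f = Σ ℚ λ c → Σ (ℚ → ℚ) λ g → IsPolynomial k g × (∀ x → f x ≡ c + x * g x)

  IsPolynomial-cong : ∀ k {f g} → (∀ x → f x ≡ g x) → IsPolynomial k f → IsPolynomial k g
  IsPolynomial-cong zero    f≡g (c , f≡c)          = c , λ x → trans (sym (f≡g x)) (f≡c x)
  IsPolynomial-cong (suc k) f≡g (c , h , poly , f≡) = c , h , poly , λ x → trans (sym (f≡g x)) (f≡ x)

  IsPolynomial-suc : ∀ k {f} → IsPolynomial k f → IsPolynomial (suc k) f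
  IsPolynomial-suc zero    (c , f≡c) = c , (λ _ → 0ℚ) , (0ℚ , λ _ → refl) ,
    λ x → trans (f≡c x) (solve 2 (λ c x → c := c :+ x :* con 0ℚ) refl c x)
  IsPolynomial-suc (suc k) (c , g , poly , f≡) = c , g , IsPolynomial-suc k poly , f≡

  IsPolynomial-+ : ∀ k {f g} → IsPolynomial k f → IsPolynomial k g → IsPolynomial k (λ x → f x + g x)
  IsPolynomial-+ zero    (c , f≡c) (d , g≡d) = c + d , λ x → cong₂ _+_ (f≡c x) (g≡d x)
  IsPolynomial-+ (suc k) (c , f′ , pf , f≡) (d , g′ , pg , g≡) =
    c + d , (λ x → f′ x + g′ x) , IsPolynomial-+ k pf pg ,
    λ x → trans (cong₂ _+_ (f≡ x) (g≡ x))
      (solve 5 (λ c d x a b → (c :+ x :* a) :+ (d :+ x :* b) := (c :+ d) :+ x :* (a :+ b)) refl c d x (f′ x) (g′ x))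

  IsPolynomial-*ˡ : ∀ k a {f} → IsPolynomial k f → IsPolynomial k (λ x → a * f x)
  IsPolynomial-*ˡ zero    a (c , f≡c)          = a * c , λ x → cong (a *_) (f≡c x)
  IsPolynomial-*ˡ (suc k) a (c , g , poly , f≡) = a * c , (λ x → a * g x) , IsPolynomial-*ˡ k a poly ,
    λ x → trans (cong (a *_) (f≡ x)) (solve 4 (λ a c x y → a :* (c :+ x :* y) := a :* c :+ x :* (a :* y)) refl a c x (g x))

  IsPolynomial-x* : ∀ k {f} → IsPolynomial k f → IsPolynomial (suc k) (λ x → x * f x)
  IsPolynomial-x* k {f} poly = 0ℚ , f , poly , λ x → sym (ℚ.+-identityˡ _)

  IsPolynomial-^ : ∀ k → IsPolynomial k (_^ k)
  IsPolynomial-^ zero    = 1ℚ , λ _ → refl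
  IsPolynomial-^ (suc k) = IsPolynomial-x* k (IsPolynomial-^ k)

  factor-theorem : ∀ k {f} → IsPolynomial (suc k) f → ∀ c →
    Σ (ℚ → ℚ) λ h → IsPolynomial k h × (∀ x → f x ≡ f c + (x - c) * h x)
  factor-theorem zero {f} (a , g , (b , g≡b) , f≡) c = (λ _ → b) , (b , λ _ → refl) , λ x → begin
      f x                             ≡⟨ trans (f≡ x) (cong (λ z → a + x * z) (g≡b x)) ⟩
      a + x * b                       ≡⟨ solve 4 (λ a b c x → a :+ x :* b := (a :+ c :* b) :+ (x :- c) :* b) refl a b c x ⟩
      (a + c * b) + (x - c) * b       ≡⟨ cong (λ z → z + (x - c) * b) (sym (trans (f≡ c) (cong (λ z → a + c * z) (g≡b c)))) ⟩
      f c + (x - c) * b               ∎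
    where open ≡-Reasoning
  factor-theorem (suc k) {f} (a , g , poly , f≡) c with factor-theorem k poly c
  ... | h , poly-h , g≡ = (λ x → g c + x * h x) , (g c , h , poly-h , λ x → refl) , λ x → begin
      f x                                           ≡⟨ trans (f≡ x) (cong (λ z → a + x * z) (g≡ x)) ⟩
      a + x * (g c + (x - c) * h x)                 ≡⟨ solve 5 (λ a G c x H → a :+ x :* (G :+ (x :- c) :* H) := (a :+ c :* G) :+ (x :- c) :* (G :+ x :* H)) refl a (g c) c x (h x) ⟩
      (a + c * g c) + (x - c) * (g c + x * h x)     ≡⟨ cong (λ z → z + (x - c) * (g c + x * h x)) (sym (f≡ c)) ⟩
      f c + (x - c) * (g c + x * h x)               ∎
    where open ≡-Reasoning

  -- A polynomial vanishing at all natural numbers from s on vanishes: divide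
  -- out the root s and use the remaining roots s + 1, s + 2, ... for the quotient.
  polynomial-vanishing : ∀ k {f} → IsPolynomial k f → ∀ s → (∀ q → f (ℕtoℚ (q +ℕ s)) ≡ 0ℚ) → ∀ x → f x ≡ 0ℚ
  polynomial-vanishing zero    (c , f≡c) s f≡0 x = trans (f≡c x) (trans (sym (f≡c _)) (f≡0 0))
  polynomial-vanishing (suc k) {f} poly s f≡0 x with factor-theorem k poly (ℕtoℚ s)
  ... | h , poly-h , f≡ = begin
      f x                                 ≡⟨ f≡ x ⟩
      f (ℕtoℚ s) + (x - ℕtoℚ s) * h x     ≡⟨ cong₂ (λ a b → a + (x - ℕtoℚ s) * b) (f≡0 0) (h≡0 x) ⟩
      0ℚ + (x - ℕtoℚ s) * 0ℚ              ≡⟨ solve 1 (λ y → con 0ℚ :+ y :* con 0ℚ := con 0ℚ) refl (x - ℕtoℚ s) ⟩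
      0ℚ                                  ∎
    where
    open ≡-Reasoning
    gap : ∀ q → ℕtoℚ (q +ℕ suc s) - ℕtoℚ s ≡ ℕtoℚ (suc q)
    gap q = begin
        ℕtoℚ (q +ℕ suc s) - ℕtoℚ s       ≡⟨ cong (_- ℕtoℚ s) (trans (cong ℕtoℚ (ℕ.+-comm q (suc s))) (ℕtoℚ-+ (suc s) q)) ⟩
        (ℕtoℚ (suc s) + ℕtoℚ q) - ℕtoℚ s ≡⟨ cong (λ z → (z + ℕtoℚ q) - ℕtoℚ s) (ℕtoℚ-+ 1 s) ⟩
        ((1ℚ + ℕtoℚ s) + ℕtoℚ q) - ℕtoℚ s ≡⟨ solve 2 (λ a b → ((con 1ℚ :+ a) :+ b) :- a := con 1ℚ :+ b) refl (ℕtoℚ s) (ℕtoℚ q) ⟩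
        1ℚ + ℕtoℚ q                      ≡⟨ sym (ℕtoℚ-+ 1 q) ⟩
        ℕtoℚ (suc q)                     ∎
    h-roots : ∀ q → h (ℕtoℚ (q +ℕ suc s)) ≡ 0ℚ
    h-roots q = ℕtoℚ-suc-*-cancel q (begin
        ℕtoℚ (suc q) * h y                      ≡⟨ cong (_* h y) (sym (gap q)) ⟩
        (y - ℕtoℚ s) * h y                      ≡⟨ sym (ℚ.+-identityˡ _) ⟩
        0ℚ + (y - ℕtoℚ s) * h y                 ≡⟨ cong (λ z → z + (y - ℕtoℚ s) * h y) (sym (f≡0 0)) ⟩
        f (ℕtoℚ s) + (y - ℕtoℚ s) * h y         ≡⟨ sym (f≡ y) ⟩
        f y                                     ≡⟨ cong (f ∘ ℕtoℚ) (ℕ.+-suc q s) ⟩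
        f (ℕtoℚ (suc q +ℕ s))                   ≡⟨ f≡0 (suc q) ⟩
        0ℚ                                      ∎)
      where y = ℕtoℚ (q +ℕ suc s)
    h≡0 : ∀ x → h x ≡ 0ℚ
    h≡0 = polynomial-vanishing k poly-h (suc s) h-roots

  -- Φ M d x = Σ_{ℓ ≤ M} d ℓ · x^ℓ · (x − 1)^(M − ℓ): the value at x of the
  -- chromatic polynomial of a combination of P_λ's with |λ| = M and weights d (ℓ(λ)).
  Φ : ℕ → (ℕ → ℚ) → ℚ → ℚ
  Φ zero    d x = d 0
  Φ (suc M) d x = (x - 1ℚ) * Φ M d x + d (suc M) * x ^ suc M

  Φ-IsPolynomial : ∀ M d → IsPolynomial M (Φ M d)
  Φ-IsPolynomial zero    d = d 0 , λ _ → refl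
  Φ-IsPolynomial (suc M) d = IsPolynomial-cong (suc M) expand
    (IsPolynomial-+ (suc M)
      (IsPolynomial-+ (suc M) (IsPolynomial-x* M (Φ-IsPolynomial M d)) (IsPolynomial-suc M (IsPolynomial-*ˡ M (- 1ℚ) (Φ-IsPolynomial M d))))
      (IsPolynomial-x* M (IsPolynomial-*ˡ M (d (suc M)) (IsPolynomial-^ M))))
    where
    expand : ∀ x → (x * Φ M d x + - 1ℚ * Φ M d x) + x * (d (suc M) * x ^ M) ≡ Φ (suc M) d x
    expand x = solve 4 (λ x y a p → (x :* y :+ (:- con 1ℚ) :* y) :+ x :* (a :* p) := (x :- con 1ℚ) :* y :+ a :* (x :* p)) refl
      x (Φ M d x) (d (suc M)) (x ^ M)

  Φ-zero : ∀ M {d} → (∀ ℓ → ℓ ≤ M → d ℓ ≡ 0ℚ) → ∀ x → Φ M d x ≡ 0ℚ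
  Φ-zero zero    d≡0 x = d≡0 0 z≤n
  Φ-zero (suc M) d≡0 x = trans
    (cong₂ (λ a b → (x - 1ℚ) * a + b * x ^ suc M) (Φ-zero M (λ ℓ ℓ≤M → d≡0 ℓ (ℕ.m≤n⇒m≤1+n ℓ≤M)) x) (d≡0 (suc M) ℕ.≤-refl))
    (solve 2 (λ a b → a :* con 0ℚ :+ con 0ℚ :* b := con 0ℚ) refl (x - 1ℚ) (x ^ suc M))

  Φ-+ : ∀ M (d d′ : ℕ → ℚ) x → Φ M (λ ℓ → d ℓ + d′ ℓ) x ≡ Φ M d x + Φ M d′ x
  Φ-+ zero    d d′ x = refl
  Φ-+ (suc M) d d′ x = trans (cong (λ z → (x - 1ℚ) * z + (d (suc M) + d′ (suc M)) * x ^ suc M) (Φ-+ M d d′ x))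
    (solve 6 (λ y a b c e p → y :* (a :+ b) :+ (c :+ e) :* p := (y :* a :+ c :* p) :+ (y :* b :+ e :* p)) refl
      (x - 1ℚ) (Φ M d x) (Φ M d′ x) (d (suc M)) (d′ (suc M)) (x ^ suc M))

  Φ-sub : ∀ M (d d′ : ℕ → ℚ) x → Φ M (λ ℓ → d ℓ - d′ ℓ) x ≡ Φ M d x - Φ M d′ x
  Φ-sub zero    d d′ x = refl
  Φ-sub (suc M) d d′ x = trans (cong (λ z → (x - 1ℚ) * z + (d (suc M) - d′ (suc M)) * x ^ suc M) (Φ-sub M d d′ x))
    (solve 6 (λ y a b c e p → y :* (a :- b) :+ (c :- e) :* p := (y :* a :+ c :* p) :- (y :* b :+ e :* p)) refl
      (x - 1ℚ) (Φ M d x) (Φ M d′ x) (d (suc M)) (d′ (suc M)) (x ^ suc M))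

  δ : ℕ → ℚ → ℕ → ℚ
  δ ℓ₀ c ℓ = if ℓ₀ ≡ᵇ ℓ then c else 0ℚ

  Φ-δ : ∀ M ℓ₀ c x → ℓ₀ ≤ M → Φ M (δ ℓ₀ c) x ≡ c * x ^ ℓ₀ * (x - 1ℚ) ^ (M ∸ ℓ₀)
  Φ-δ zero    zero c x z≤n = sym (trans (ℚ.*-identityʳ _) (ℚ.*-identityʳ _))
  Φ-δ (suc M) ℓ₀ c x ℓ₀≤ with ℓ₀ ≡ᵇ suc M in ℓ₀≡ᵇ
  ... | true with ≡ᵇ-true⇒≡ {ℓ₀} ℓ₀≡ᵇ
  ...   | refl = begin
      (x - 1ℚ) * Φ M (δ (suc M) c) x + c * x ^ suc M
    ≡⟨ cong (λ a → (x - 1ℚ) * a + c * x ^ suc M) (Φ-zero M below x) ⟩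
      (x - 1ℚ) * 0ℚ + c * x ^ suc M
    ≡⟨ solve 3 (λ y c p → y :* con 0ℚ :+ c :* p := c :* p :* con 1ℚ) refl (x - 1ℚ) c (x ^ suc M) ⟩
      c * x ^ suc M * 1ℚ
    ≡⟨ cong (λ k → c * x ^ suc M * (x - 1ℚ) ^ k) (sym (ℕ.n∸n≡0 (suc M))) ⟩
      c * x ^ suc M * (x - 1ℚ) ^ (suc M ∸ suc M)
    ∎
    where
    open ≡-Reasoning
    below : ∀ ℓ → ℓ ≤ M → δ (suc M) c ℓ ≡ 0ℚ
    below ℓ ℓ≤M with suc M ≡ᵇ ℓ in 1+M≡ᵇℓ
    ... | true  = ⊥-elim (ℕ.<-irrefl (sym (≡ᵇ-true⇒≡ 1+M≡ᵇℓ)) (s≤s ℓ≤M))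
    ... | false = refl
  Φ-δ (suc M) ℓ₀ c x ℓ₀≤ | false = begin
      (x - 1ℚ) * Φ M (δ ℓ₀ c) x + 0ℚ * x ^ suc M
    ≡⟨ cong (λ a → (x - 1ℚ) * a + 0ℚ * x ^ suc M) (Φ-δ M ℓ₀ c x ℓ₀≤M) ⟩
      (x - 1ℚ) * (c * x ^ ℓ₀ * (x - 1ℚ) ^ (M ∸ ℓ₀)) + 0ℚ * x ^ suc M
    ≡⟨ solve 5 (λ y c p r s → y :* (c :* p :* r) :+ con 0ℚ :* s := c :* p :* (y :* r)) refl
         (x - 1ℚ) c (x ^ ℓ₀) ((x - 1ℚ) ^ (M ∸ ℓ₀)) (x ^ suc M) ⟩
      c * x ^ ℓ₀ * (x - 1ℚ) ^ suc (M ∸ ℓ₀)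
    ≡⟨ cong (λ k → c * x ^ ℓ₀ * (x - 1ℚ) ^ k) (sym (ℕ.+-∸-assoc 1 ℓ₀≤M)) ⟩
      c * x ^ ℓ₀ * (x - 1ℚ) ^ (suc M ∸ ℓ₀)
    ∎
    where
    open ≡-Reasoning
    ℓ₀≤M : ℓ₀ ≤ M
    ℓ₀≤M = ℕ.≤-pred (ℕ.≤∧≢⇒< ℓ₀≤ λ { refl → ≡false⇒≢true ℓ₀≡ᵇ (≡⇒≡ᵇ-true {suc M} refl) })

  1^≡1 : ∀ k → 1ℚ ^ k ≡ 1ℚ
  1^≡1 zero    = refl
  1^≡1 (suc k) = trans (ℚ.*-identityˡ _) (1^≡1 k)

  Φ-at-1 : ∀ M d → Φ (suc M) d 1ℚ ≡ d (suc M)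
  Φ-at-1 M d = begin
      (1ℚ - 1ℚ) * Φ M d 1ℚ + d (suc M) * 1ℚ ^ suc M   ≡⟨ cong (λ z → 0ℚ * Φ M d 1ℚ + d (suc M) * z) (1^≡1 (suc M)) ⟩
      0ℚ * Φ M d 1ℚ + d (suc M) * 1ℚ                  ≡⟨ solve 2 (λ y a → con 0ℚ :* y :+ a :* con 1ℚ := a) refl (Φ M d 1ℚ) (d (suc M)) ⟩
      d (suc M)                                       ∎
    where open ≡-Reasoning

  -- The top coefficient is the value at x = 1; once it vanishes, the factor
  -- x − 1 cancels at x = 2, 3, ..., and these roots make Φ M d vanish.
  Φ-unique : ∀ M d → (∀ q → Φ M d (ℕtoℚ (suc q)) ≡ 0ℚ) → ∀ ℓ → ℓ ≤ M → d ℓ ≡ 0ℚ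
  Φ-unique zero    d Φ≡0 zero z≤n = Φ≡0 0
  Φ-unique (suc M) d Φ≡0 ℓ ℓ≤ with ℓ ℕ.≟ suc M
  ... | yes refl = trans (sym (Φ-at-1 M d)) (Φ≡0 0)
  ... | no ℓ≢ = Φ-unique M d (λ q → Φ≡0′ _) ℓ (ℕ.≤-pred (ℕ.≤∧≢⇒< ℓ≤ ℓ≢))
    where
    top≡0 : d (suc M) ≡ 0ℚ
    top≡0 = trans (sym (Φ-at-1 M d)) (Φ≡0 0)
    Φ≡0-from-2 : ∀ q → Φ M d (ℕtoℚ (q +ℕ 2)) ≡ 0ℚ
    Φ≡0-from-2 q = ℕtoℚ-suc-*-cancel q (begin
        ℕtoℚ (suc q) * Φ M d x                            ≡⟨ cong (_* Φ M d x) (sym x-1) ⟩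
        (x - 1ℚ) * Φ M d x                                ≡⟨ solve 3 (λ a b p → a :* b := a :* b :+ con 0ℚ :* p) refl (x - 1ℚ) (Φ M d x) (x ^ suc M) ⟩
        (x - 1ℚ) * Φ M d x + 0ℚ * x ^ suc M               ≡⟨ cong (λ z → (x - 1ℚ) * Φ M d x + z * x ^ suc M) (sym top≡0) ⟩
        Φ (suc M) d x                                     ≡⟨ cong (λ k → Φ (suc M) d (ℕtoℚ k)) (ℕ.+-comm q 2) ⟩
        Φ (suc M) d (ℕtoℚ (suc (suc q)))                  ≡⟨ Φ≡0 (suc q) ⟩
        0ℚ                                                ∎)
      where
      open ≡-Reasoning
      x = ℕtoℚ (q +ℕ 2)
      x-1 : x - 1ℚ ≡ ℕtoℚ (suc q)
      x-1 = trans (cong (λ k → ℕtoℚ k - 1ℚ) (ℕ.+-comm q 2)) (ℕtoℚ-suc-1 (suc q))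
    Φ≡0′ : ∀ x → Φ M d x ≡ 0ℚ
    Φ≡0′ = polynomial-vanishing M (Φ-IsPolynomial M d) 2 Φ≡0-from-2

  Φ-injective : ∀ M d d′ → (∀ q → Φ M d (ℕtoℚ (suc q)) ≡ Φ M d′ (ℕtoℚ (suc q))) →
    ∀ ℓ → ℓ ≤ M → d ℓ ≡ d′ ℓ
  Φ-injective M d d′ Φ≡Φ ℓ ℓ≤M = x∙y⁻¹≈ε⇒x≈y (d ℓ) (d′ ℓ)
    (Φ-unique M (λ ℓ → d ℓ - d′ ℓ) (λ q → trans (Φ-sub M d d′ _) (x≈y⇒x∙y⁻¹≈ε (Φ≡Φ q))) ℓ ℓ≤M)

module TreePolynomial where

  open Counting using (∧-elim; ≡ᵇ-true⇒≡)
  open ChromaticPolynomial using (chromatic; chromatic-P; chromatic-glue; length≤sum; degree; exponentsUpTo; sum-coeffX-by-degree)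
  open Polynomials
  open import Data.Nat using (_<ᵇ_) renaming (_+_ to _+ℕ_; _*_ to _*ℕ_; _^_ to _^ℕ_)
  import Data.Nat.Properties as ℕ
  open import Data.Rational using (ℚ; 0ℚ; 1ℚ; _+_; _*_; _-_)
  import Data.Rational.Properties as ℚ
  open import Data.Rational.Solver using (module +-*-Solver)
  open +-*-Solver using (solve; _:=_; con; _:+_; _:*_)
  open import Data.Bool.Properties using (T-≡)
  open import Data.List.Properties using (map-∘)
  open import Function.Bundles using (Equivalence)
  open import Algebra.Properties.Semiring.Exp (CommutativeSemiring.semiring ℚ-semiring) using (_^_; ^-homo-*)
  open ListSum ℚ-semiring using (sum-cong; sum-cong-All; sum-zero; sum-+; sum-*ˡ; sum-swap)

  -- A term c · X_{P_λ} of an expansion, remembering only |λ| and ℓ(λ).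
  record Term : Set where
    constructor term
    field
      size  : ℕ
      parts : ℕ
      coeff : ℚ
  open Term

  terms : LinComb → List Term
  terms = map λ e → term (sumℕ (proj₁ e)) (length (proj₁ e)) (proj₂ e)

  shift : ℕ → Term → Term
  shift m (term N ℓ c) = term (N +ℕ m) ℓ c

  Valid : List Term → Set
  Valid = All λ e → parts e ≤ size e

  eval : List Term → (ℕ → Bool) → ℚ → ℚ
  eval C D x = sumℚ (map (λ e → if D (size e) then coeff e * x ^ parts e * (x - 1ℚ) ^ (size e ∸ parts e) else 0ℚ) C)

  weight : List Term → ℕ → ℕ → ℚ
  weight C M ℓ = sumℚ (map (λ e → if (size e ≡ᵇ M) ∧ (parts e ≡ᵇ ℓ) then coeff e else 0ℚ) C)

  partsWeight : List Term → ℕ → ℚ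
  partsWeight C ℓ = sumℚ (map (λ e → if parts e ≡ᵇ ℓ then coeff e else 0ℚ) C)

  eval-term-Φ : ∀ e → parts e ≤ size e → ∀ M x →
    (if size e ≡ᵇ M then coeff e * x ^ parts e * (x - 1ℚ) ^ (size e ∸ parts e) else 0ℚ)
    ≡ Φ M (λ ℓ → if (size e ≡ᵇ M) ∧ (parts e ≡ᵇ ℓ) then coeff e else 0ℚ) x
  eval-term-Φ (term N ℓ c) ℓ≤N M x with N ≡ᵇ M in N≡ᵇM
  ... | false = sym (Φ-zero M (λ _ _ → refl) x)
  ... | true with ≡ᵇ-true⇒≡ {N} {M} N≡ᵇM
  ...   | refl = sym (Φ-δ N ℓ c x ℓ≤N)

  eval-Φ : ∀ C → Valid C → ∀ M x → eval C (_≡ᵇ M) x ≡ Φ M (weight C M) x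
  eval-Φ []       []            M x = sym (Φ-zero M (λ _ _ → refl) x)
  eval-Φ (e ∷ C) (ℓ≤N ∷ valid) M x =
    trans (cong₂ _+_ (eval-term-Φ e ℓ≤N M x) (eval-Φ C valid M x)) (sym (Φ-+ M _ (weight C M) x))

  weight-beyond : ∀ C → Valid C → ∀ {M ℓ} → M < ℓ → weight C M ℓ ≡ 0ℚ
  weight-beyond C valid {M} {ℓ} M<ℓ = trans (sum-cong-All (All.map zero-term valid)) (sum-zero (λ _ → refl) C)
    where
    zero-term : ∀ {e} → parts e ≤ size e → (if (size e ≡ᵇ M) ∧ (parts e ≡ᵇ ℓ) then coeff e else 0ℚ) ≡ 0ℚ
    zero-term {term N ℓ′ c} ℓ′≤N with (N ≡ᵇ M) ∧ (ℓ′ ≡ᵇ ℓ) in e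
    ... | false = refl
    ... | true with ≡ᵇ-true⇒≡ {N} {M} (proj₁ (∧-elim e)) | ≡ᵇ-true⇒≡ {ℓ′} {ℓ} (proj₂ (∧-elim {N ≡ᵇ M} e))
    ...   | refl | refl = ⊥-elim (ℕ.<-irrefl refl (ℕ.<-≤-trans M<ℓ ℓ′≤N))

  weight-unique : ∀ C C′ → Valid C → Valid C′ → ∀ M →
    (∀ q → eval C (_≡ᵇ M) (ℕtoℚ (suc q)) ≡ eval C′ (_≡ᵇ M) (ℕtoℚ (suc q))) →
    ∀ ℓ → weight C M ℓ ≡ weight C′ M ℓ
  weight-unique C C′ valid valid′ M eval≡ ℓ with ℓ ℕ.≤? M
  ... | yes ℓ≤M = Φ-injective M (weight C M) (weight C′ M)
        (λ q → trans (sym (eval-Φ C valid M _)) (trans (eval≡ q) (eval-Φ C′ valid′ M _))) ℓ ℓ≤M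
  ... | no ℓ≰M = trans (weight-beyond C valid (ℕ.≰⇒> ℓ≰M)) (sym (weight-beyond C′ valid′ (ℕ.≰⇒> ℓ≰M)))

  partsWeightBelow : List Term → ℕ → ℕ → ℚ
  partsWeightBelow C K ℓ = sumℚ (map (λ e → if (size e <ᵇ K) ∧ (parts e ≡ᵇ ℓ) then coeff e else 0ℚ) C)

  partsWeightBelow-suc : ∀ C K ℓ → partsWeightBelow C (suc K) ℓ ≡ partsWeightBelow C K ℓ + weight C K ℓ
  partsWeightBelow-suc C K ℓ = trans (sum-cong (λ e → split (size e) K (parts e ≡ᵇ ℓ) (coeff e)) C) (sum-+ _ _ C)
    where
    split : ∀ N K b c → (if (N <ᵇ suc K) ∧ b then c else 0ℚ)
                      ≡ (if (N <ᵇ K) ∧ b then c else 0ℚ) + (if (N ≡ᵇ K) ∧ b then c else 0ℚ)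
    split zero    zero    b c = sym (ℚ.+-identityˡ _)
    split (suc N) zero    b c = refl
    split zero    (suc K) b c = sym (ℚ.+-identityʳ _)
    split (suc N) (suc K) b c = split N K b c

  partsWeightBelow-all : ∀ C K ℓ → All (λ e → size e < K) C → partsWeightBelow C K ℓ ≡ partsWeight C ℓ
  partsWeightBelow-all C K ℓ sizes<K = sum-cong-All (All.map (λ {e} → below e) sizes<K)
    where
    below : ∀ e → size e < K →
      (if (size e <ᵇ K) ∧ (parts e ≡ᵇ ℓ) then coeff e else 0ℚ) ≡ (if parts e ≡ᵇ ℓ then coeff e else 0ℚ)
    below e s<K = cong (λ b → if b ∧ (parts e ≡ᵇ ℓ) then coeff e else 0ℚ) (Equivalence.to T-≡ (ℕ.<⇒<ᵇ s<K))

  size≤total : ∀ C → All (λ e → size e ≤ sumℕ (map size C)) C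
  size≤total []      = []
  size≤total (e ∷ C) = ℕ.m≤m+n (size e) _ ∷ All.map (λ s≤ → ℕ.≤-trans s≤ (ℕ.m≤n+m _ (size e))) (size≤total C)

  -- partsWeight C ℓ is the sum over the sizes M of weight C M ℓ.
  partsWeight-cong : ∀ C C′ ℓ → (∀ M → weight C M ℓ ≡ weight C′ M ℓ) → partsWeight C ℓ ≡ partsWeight C′ ℓ
  partsWeight-cong C C′ ℓ weight≡ = begin
      partsWeight C ℓ            ≡⟨ sym (partsWeightBelow-all C K ℓ sizes<K) ⟩
      partsWeightBelow C K ℓ     ≡⟨ below≡ K ⟩
      partsWeightBelow C′ K ℓ    ≡⟨ partsWeightBelow-all C′ K ℓ sizes′<K ⟩
      partsWeight C′ ℓ           ∎
    where
    open ≡-Reasoning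
    K = suc (sumℕ (map size C) +ℕ sumℕ (map size C′))
    sizes<K : All (λ e → size e < K) C
    sizes<K = All.map (λ s≤ → s≤s (ℕ.≤-trans s≤ (ℕ.m≤m+n _ _))) (size≤total C)
    sizes′<K : All (λ e → size e < K) C′
    sizes′<K = All.map (λ s≤ → s≤s (ℕ.≤-trans s≤ (ℕ.m≤n+m _ _))) (size≤total C′)
    below≡ : ∀ K → partsWeightBelow C K ℓ ≡ partsWeightBelow C′ K ℓ
    below≡ zero    = trans (sum-zero (λ _ → refl) C) (sym (sum-zero (λ _ → refl) C′))
    below≡ (suc K) = trans (partsWeightBelow-suc C K ℓ)
      (trans (cong₂ _+_ (below≡ K) (weight≡ K)) (sym (partsWeightBelow-suc C′ K ℓ)))

  terms-valid : ∀ A → All (λ e → IsPartition (proj₁ e)) A → Valid (terms A)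
  terms-valid []      []                  = []
  terms-valid (e ∷ A) ((parts≥1 , _) ∷ ps) = length≤sum (proj₁ e) parts≥1 ∷ terms-valid A ps

  shift-valid : ∀ m {C} → Valid C → Valid (map (shift m) C)
  shift-valid m []              = []
  shift-valid m (ℓ≤N ∷ valid) = ℕ.≤-trans ℓ≤N (ℕ.m≤m+n _ m) ∷ shift-valid m valid

  treeCoeff-terms : ∀ A ℓ → treeCoeff A ℓ ≡ partsWeight (terms A) ℓ
  treeCoeff-terms A ℓ = cong sumℚ (map-∘ A)

  partsWeight-shift : ∀ m C ℓ → partsWeight (map (shift m) C) ℓ ≡ partsWeight C ℓ
  partsWeight-shift m C ℓ = sym (cong sumℚ (map-∘ C))

  eval-shift : ∀ m C → Valid C → ∀ M x → eval (map (shift m) C) (_≡ᵇ M) x ≡ (x - 1ℚ) ^ m * eval C (λ N → N +ℕ m ≡ᵇ M) x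
  eval-shift m []                []            M x = sym (ℚ.*-zeroʳ ((x - 1ℚ) ^ m))
  eval-shift m (term N ℓ c ∷ C) (ℓ≤N ∷ valid) M x =
    trans (cong₂ _+_ (shifted (N +ℕ m ≡ᵇ M)) (eval-shift m C valid M x)) (sym (ℚ.*-distribˡ-+ ((x - 1ℚ) ^ m) _ _))
    where
    shifted : ∀ b → (if b then c * x ^ ℓ * (x - 1ℚ) ^ (N +ℕ m ∸ ℓ) else 0ℚ)
                  ≡ (x - 1ℚ) ^ m * (if b then c * x ^ ℓ * (x - 1ℚ) ^ (N ∸ ℓ) else 0ℚ)
    shifted false = sym (ℚ.*-zeroʳ ((x - 1ℚ) ^ m))
    shifted true  = begin
        c * x ^ ℓ * (x - 1ℚ) ^ (N +ℕ m ∸ ℓ)              ≡⟨ cong (λ k → c * x ^ ℓ * (x - 1ℚ) ^ k) (ℕ.+-∸-comm m ℓ≤N) ⟩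
        c * x ^ ℓ * (x - 1ℚ) ^ (N ∸ ℓ +ℕ m)              ≡⟨ cong (c * x ^ ℓ *_) (^-homo-* (x - 1ℚ) (N ∸ ℓ) m) ⟩
        c * x ^ ℓ * ((x - 1ℚ) ^ (N ∸ ℓ) * (x - 1ℚ) ^ m)  ≡⟨ solve 4 (λ a b r s → a :* b :* (r :* s) := s :* (a :* b :* r)) refl c (x ^ ℓ) ((x - 1ℚ) ^ (N ∸ ℓ)) ((x - 1ℚ) ^ m) ⟩
        (x - 1ℚ) ^ m * (c * x ^ ℓ * (x - 1ℚ) ^ (N ∸ ℓ))  ∎
      where open ≡-Reasoning

  -- Sum the identity of coefficients in IsPExpansion over all monomials whose
  -- degree passes D: both sides become chromatic polynomials.
  chromatic-expansion : ∀ {n} (G : Graph n) A → IsPExpansion G A → ∀ q M (D : ℕ → Bool) → (∀ s → D s ≡ true → s ≤ M) →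
    ℕtoℚ (if D n then chromatic G q else 0)
    ≡ sumℚ (map (λ e → proj₂ e * ℕtoℚ (if D (sumℕ (proj₁ e)) then chromatic (P (proj₁ e)) q else 0)) A)
  chromatic-expansion {n} G A (_ , coeffs≡) q M D D⇒≤M = begin
      ℕtoℚ (if D n then chromatic G q else 0)
    ≡⟨ cong ℕtoℚ (sym (sum-coeffX-by-degree G q M D D⇒≤M)) ⟩
      ℕtoℚ (sumℕ (map (λ α → if D (degree α) then coeffX G q α else 0) αs))
    ≡⟨ ℕtoℚ-sum _ αs ⟩
      sumℚ (map (λ α → ℕtoℚ (if D (degree α) then coeffX G q α else 0)) αs)
    ≡⟨ sum-cong (λ α → expand α (D (degree α))) αs ⟩
      sumℚ (map (λ α → sumℚ (map (λ e → proj₂ e * ℕtoℚ (if D (degree α) then coeffX (P (proj₁ e)) q α else 0)) A)) αs)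
    ≡⟨ sum-swap (λ α e → proj₂ e * ℕtoℚ (if D (degree α) then coeffX (P (proj₁ e)) q α else 0)) αs A ⟩
      sumℚ (map (λ e → sumℚ (map (λ α → proj₂ e * ℕtoℚ (if D (degree α) then coeffX (P (proj₁ e)) q α else 0)) αs)) A)
    ≡⟨ sum-cong (λ e → trans (sum-*ˡ (proj₂ e) _ αs)
         (cong (proj₂ e *_) (trans (sym (ℕtoℚ-sum _ αs)) (cong ℕtoℚ (sum-coeffX-by-degree (P (proj₁ e)) q M D D⇒≤M))))) A ⟩
      sumℚ (map (λ e → proj₂ e * ℕtoℚ (if D (sumℕ (proj₁ e)) then chromatic (P (proj₁ e)) q else 0)) A)
    ∎
    where
    open ≡-Reasoning
    αs = exponentsUpTo q M
    expand : ∀ α b → ℕtoℚ (if b then coeffX G q α else 0)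
                   ≡ sumℚ (map (λ e → proj₂ e * ℕtoℚ (if b then coeffX (P (proj₁ e)) q α else 0)) A)
    expand α true  = coeffs≡ q α
    expand α false = sym (sum-zero (λ e → ℚ.*-zeroʳ (proj₂ e)) A)

  eval-terms : ∀ {n} (G : Graph n) A → IsPExpansion G A → ∀ q M (D : ℕ → Bool) → (∀ s → D s ≡ true → s ≤ M) →
    eval (terms A) D (ℕtoℚ (suc q)) ≡ ℕtoℚ (if D n then chromatic G (suc q) else 0)
  eval-terms {n} G A expansion q M D D⇒≤M = begin
      eval (terms A) D x
    ≡⟨ sym (cong sumℚ (map-∘ A)) ⟩
      sumℚ (map (λ e → if D (sumℕ (proj₁ e)) then proj₂ e * x ^ length (proj₁ e) * (x - 1ℚ) ^ (sumℕ (proj₁ e) ∸ length (proj₁ e)) else 0ℚ) A)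
    ≡⟨ sum-cong-All (All.map (λ {e} partition → chromatic-P-term e partition (D (sumℕ (proj₁ e)))) (proj₁ expansion)) ⟩
      sumℚ (map (λ e → proj₂ e * ℕtoℚ (if D (sumℕ (proj₁ e)) then chromatic (P (proj₁ e)) (suc q) else 0)) A)
    ≡⟨ sym (chromatic-expansion G A expansion (suc q) M D D⇒≤M) ⟩
      ℕtoℚ (if D n then chromatic G (suc q) else 0)
    ∎
    where
    open ≡-Reasoning
    x = ℕtoℚ (suc q)
    chromatic-P-term : ∀ e → IsPartition (proj₁ e) → ∀ b →
      (if b then proj₂ e * x ^ length (proj₁ e) * (x - 1ℚ) ^ (sumℕ (proj₁ e) ∸ length (proj₁ e)) else 0ℚ)
      ≡ proj₂ e * ℕtoℚ (if b then chromatic (P (proj₁ e)) (suc q) else 0)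
    chromatic-P-term e _ false = sym (ℚ.*-zeroʳ (proj₂ e))
    chromatic-P-term (λ′ , c) (parts≥1 , _) true = sym (begin
        c * ℕtoℚ (chromatic (P λ′) (suc q))
      ≡⟨ cong (λ k → c * ℕtoℚ k) (chromatic-P (suc q) λ′ parts≥1) ⟩
        c * ℕtoℚ (suc q ^ℕ length λ′ *ℕ q ^ℕ (sumℕ λ′ ∸ length λ′))
      ≡⟨ cong (c *_) (trans (ℕtoℚ-* (suc q ^ℕ length λ′) _) (cong₂ _*_ (ℕtoℚ-^ (suc q) (length λ′)) (ℕtoℚ-^ q (sumℕ λ′ ∸ length λ′)))) ⟩
        c * (x ^ length λ′ * ℕtoℚ q ^ (sumℕ λ′ ∸ length λ′))
      ≡⟨ cong (λ y → c * (x ^ length λ′ * y ^ (sumℕ λ′ ∸ length λ′))) (sym (ℕtoℚ-suc-1 q)) ⟩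
        c * (x ^ length λ′ * (x - 1ℚ) ^ (sumℕ λ′ ∸ length λ′))
      ≡⟨ sym (ℚ.*-assoc c _ _) ⟩
        c * x ^ length λ′ * (x - 1ℚ) ^ (sumℕ λ′ ∸ length λ′)
      ∎)

  -- Gluing a tree with m further vertices multiplies the chromatic polynomial
  -- by (x − 1)^m, exactly as shifting every size by m does.
  eval-glue : ∀ {n m} (G : Graph n) (v : Fin n) (T : Graph (suc m)) (t : Fin (suc m)) → IsTree T →
    ∀ A B → IsPExpansion G A → IsPExpansion (glue G v T t) B →
    ∀ M q → eval (map (shift m) (terms A)) (_≡ᵇ M) (ℕtoℚ (suc q)) ≡ eval (terms B) (_≡ᵇ M) (ℕtoℚ (suc q))
  eval-glue {n} {m} G v T t tree A B expA expB M q = begin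
      eval (map (shift m) (terms A)) (_≡ᵇ M) x
    ≡⟨ eval-shift m (terms A) (terms-valid A (proj₁ expA)) M x ⟩
      (x - 1ℚ) ^ m * eval (terms A) (λ N → N +ℕ m ≡ᵇ M) x
    ≡⟨ cong₂ _*_ (trans (cong (_^ m) (ℕtoℚ-suc-1 q)) (sym (ℕtoℚ-^ q m)))
                 (eval-terms G A expA q M (λ N → N +ℕ m ≡ᵇ M) (λ s e → subst (s ≤_) (≡ᵇ-true⇒≡ e) (ℕ.m≤m+n s m))) ⟩
      ℕtoℚ (q ^ℕ m) * ℕtoℚ (if n +ℕ m ≡ᵇ M then chromatic G (suc q) else 0)
    ≡⟨ scale (n +ℕ m ≡ᵇ M) ⟩
      ℕtoℚ (if n +ℕ m ≡ᵇ M then chromatic G (suc q) *ℕ q ^ℕ m else 0)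
    ≡⟨ cong (λ k → ℕtoℚ (if n +ℕ m ≡ᵇ M then k else 0)) (sym (chromatic-glue (suc q) G v T t tree)) ⟩
      ℕtoℚ (if n +ℕ m ≡ᵇ M then chromatic (glue G v T t) (suc q) else 0)
    ≡⟨ sym (eval-terms (glue G v T t) B expB q M (_≡ᵇ M) (λ s e → ℕ.≤-reflexive (≡ᵇ-true⇒≡ e))) ⟩
      eval (terms B) (_≡ᵇ M) x
    ∎
    where
    open ≡-Reasoning
    x = ℕtoℚ (suc q)
    scale : ∀ b → ℕtoℚ (q ^ℕ m) * ℕtoℚ (if b then chromatic G (suc q) else 0)
                ≡ ℕtoℚ (if b then chromatic G (suc q) *ℕ q ^ℕ m else 0)
    scale false = ℚ.*-zeroʳ (ℕtoℚ (q ^ℕ m))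
    scale true  = trans (ℚ.*-comm (ℕtoℚ (q ^ℕ m)) _) (sym (ℕtoℚ-* (chromatic G (suc q)) (q ^ℕ m)))

open TreePolynomial

corollary4p2 : ∀ {n m : ℕ} (G : Graph n) (T : Graph (suc m)) (v : Fin n) (t : Fin (suc m)) →
    SimpleGraph G → IsTree T →
    (A B : LinComb) → IsPExpansion G A → IsPExpansion (glue G v T t) B →
    ∀ (ℓ : ℕ) → treeCoeff A ℓ ≡ treeCoeff B ℓ
corollary4p2 {m = m} G T v t _ tree A B expA expB ℓ = begin
    treeCoeff A ℓ                  ≡⟨ treeCoeff-terms A ℓ ⟩
    partsWeight (terms A) ℓ        ≡⟨ sym (partsWeight-shift m (terms A) ℓ) ⟩
    partsWeight shifted-A ℓ        ≡⟨ partsWeight-cong shifted-A (terms B) ℓ same-weights ⟩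
    partsWeight (terms B) ℓ        ≡⟨ sym (treeCoeff-terms B ℓ) ⟩
    treeCoeff B ℓ                  ∎
  where
  open ≡-Reasoning
  shifted-A = map (shift m) (terms A)
  same-weights : ∀ M → weight shifted-A M ℓ ≡ weight (terms B) M ℓ
  same-weights M = weight-unique shifted-A (terms B)
    (shift-valid m (terms-valid A (proj₁ expA))) (terms-valid B (proj₁ expB)) M
    (eval-glue G v T t tree A B expA expB M) ℓ
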